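{- Let $(\mathcal{C},\oplus,0,\otimes,1)$ be a finite coproduct-copy discard rig category and let $(T,\eta,\mu,m)$ be a symmetric monoidal monad on $(\mathcal{C},\otimes,1)$. Then the Kleisli category $\mathcal{C}_T$ is a finite coproduct-copy discard rig category, with monoidal product $\otimes_T$ (equal to $\otimes$ on objects, $f\otimes_T g:=(f\otimes g);m$ on Kleisli arrows), with $\oplus$, $0$ and all structural isomorphisms and monoids induced via the canonical functor $\mathcal{K}\colon\mathcal{C}\to\mathcal{C}_T$, and with comonoids $\mathrm{copy}^\flat_X:=\mathrm{copy}_X;\eta_{X\otimes X}$ and $\mathrm{disc}^\flat_X:=\mathrm{disc}_X;\eta_1$.
   Context: Composition is diagrammatic. A symmetric monoidal monad on $(\mathcal{C},\otimes,1)$ is a monad $(T,\eta,\mu)$ with a natural $m_{X,Y}\colon TX\otimes TY\to T(X\otimes Y)$ making $T$ lax symmetric monoidal and $\eta,\mu$ monoidal. $\mathcal{K}(f)=f;\eta$. A rig category has symmetric monoidal structures $(\otimes,1)$, $(\oplus,0)$ with natural isos $\delta^l_{X,Y,Z}\colon X\otimes(Y\oplus Z)\to(X\otimes Y)\oplus(X\otimes Z)$, $\delta^r_{X,Y,Z}\colon(X\oplus Y)\otimes Z\to(X\otimes Z)\oplus(Y\otimes Z)$, $\lambda^\bullet_X\colon0\otimes X\to0$, $\rho^\bullet_X\colon X\otimes0\to0$ satisfying Laplaza's coherence axioms; $\lambda^\oplus,\rho^\oplus$ are the unitors of $\oplus$. An fc category is a symmetric monoidal $(\mathcal{C},\oplus,0)$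 with natural coherent commutative monoids $(\nabla_X\colon X\oplus X\to X,¡_X\colon0\to X)$. A cd category is a symmetric monoidal $(\mathcal{C},\otimes,1)$ with cocommutative comonoids $(\mathrm{copy}_X\colon X\to X\otimes X,\mathrm{disc}_X\colon X\to1)$ coherent with $\otimes$ ($\mathrm{copy}_{X\otimes Y}$ is $\mathrm{copy}_X\otimes\mathrm{copy}_Y$ followed by the middle interchange, $\mathrm{disc}_{X\otimes Y}=(\mathrm{disc}_X\otimes\mathrm{disc}_Y);\lambda_1$, $\mathrm{copy}_1=\lambda_1^{ -1}$, $\mathrm{disc}_1=\mathrm{id}_1$), not necessarily natural. An fc-cd rig category is a rig category with such monoids and comonoids such that the $\oplus$-part is fc, the $\otimes$-part is cd, and for all $X,Y$: $\mathrm{disc}_{X\oplus Y}=(\mathrm{disc}_X\oplus\mathrm{disc}_Y);\nabla_1$ and $\mathrm{copy}_{X\oplus Y}=((\rho^\oplus_X)^{ -1}\oplus(\lambda^\oplus_Y)^{ -1});((\mathrm{copy}_X\oplus ¡_{X\otimes Y})\oplus(¡_{Y\otimes X}\oplus\mathrm{copy}_Y));((\delta^l_{X,X,Y})^{ -1}\oplus(\delta^l_{Y,X,Y})^{ -1});(\delta^r_{X,Y,X\oplus Y})^{ -1}$. -}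

module Defs where

open import Level using (Level; _⊔_) renaming (suc to lsuc)
open import Relation.Binary using (Rel; IsEquivalence)

-- Categories (hom-setoids), composition written diagrammatically: f ⨾ g
-- means "first f, then g".

record Cat (o ℓ e : Level) : Set (lsuc (o ⊔ ℓ ⊔ e)) where
  infix  4 _≈_
  infixr 5 _⨾_
  field
    Obj : Set o
    _⇒_ : Obj → Obj → Set ℓ
    _≈_ : ∀ {A B} → Rel (A ⇒ B) e
    id  : ∀ {A} → A ⇒ A
    _⨾_ : ∀ {A B D} → A ⇒ B → B ⇒ D → A ⇒ D

module _ {o ℓ e} (C : Cat o ℓ e) where
  open Cat C

  record IsCategory : Set (o ⊔ ℓ ⊔ e) where
    field
      equiv     : ∀ {A B} → IsEquivalence (_≈_ {A} {B})
      ⨾-resp-≈  : ∀ {A B D} {f f' : A ⇒ B} {g g' : B ⇒ D} →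
                  f ≈ f' → g ≈ g' → (f ⨾ g) ≈ (f' ⨾ g')
      identityˡ : ∀ {A B} (f : A ⇒ B) → (id ⨾ f) ≈ f
      identityʳ : ∀ {A B} (f : A ⇒ B) → (f ⨾ id) ≈ f
      assoc     : ∀ {A B D E} (f : A ⇒ B) (g : B ⇒ D) (h : D ⇒ E) →
                  ((f ⨾ g) ⨾ h) ≈ (f ⨾ (g ⨾ h))

  record MonoidalData : Set (o ⊔ ℓ) where
    infixr 8 _⊗₀_ _⊗₁_
    field
      _⊗₀_     : Obj → Obj → Obj
      _⊗₁_     : ∀ {A B A' B'} → A ⇒ A' → B ⇒ B' → (A ⊗₀ B) ⇒ (A' ⊗₀ B')
      unit     : Obj
      α        : ∀ A B D → ((A ⊗₀ B) ⊗₀ D) ⇒ (A ⊗₀ (B ⊗₀ D))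
      α⁻¹      : ∀ A B D → (A ⊗₀ (B ⊗₀ D)) ⇒ ((A ⊗₀ B) ⊗₀ D)
      unitorˡ   : ∀ A → (unit ⊗₀ A) ⇒ A
      unitorˡ⁻¹ : ∀ A → A ⇒ (unit ⊗₀ A)
      unitorʳ   : ∀ A → (A ⊗₀ unit) ⇒ A
      unitorʳ⁻¹ : ∀ A → A ⇒ (A ⊗₀ unit)
      σ        : ∀ A B → (A ⊗₀ B) ⇒ (B ⊗₀ A)

  module _ (M : MonoidalData) where
    open MonoidalData M

    interchange : ∀ W X Y Z → ((W ⊗₀ X) ⊗₀ (Y ⊗₀ Z)) ⇒ ((W ⊗₀ Y) ⊗₀ (X ⊗₀ Z))
    interchange W X Y Z =
      α W X (Y ⊗₀ Z) ⨾ (id {W} ⊗₁ α⁻¹ X Y Z) ⨾ (id {W} ⊗₁ (σ X Y ⊗₁ id {Z}))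
      ⨾ (id {W} ⊗₁ α Y X Z) ⨾ α⁻¹ W Y (X ⊗₀ Z)

    record IsSymmetricMonoidal : Set (o ⊔ ℓ ⊔ e) where
      field
        ⊗-id     : ∀ {A B} → (id {A} ⊗₁ id {B}) ≈ id
        ⊗-comp   : ∀ {A B D A' B' D'} (f : A ⇒ B) (g : B ⇒ D) (f' : A' ⇒ B') (g' : B' ⇒ D') →
                   ((f ⨾ g) ⊗₁ (f' ⨾ g')) ≈ ((f ⊗₁ f') ⨾ (g ⊗₁ g'))
        ⊗-resp-≈ : ∀ {A B A' B'} {f g : A ⇒ B} {f' g' : A' ⇒ B'} →
                   f ≈ g → f' ≈ g' → (f ⊗₁ f') ≈ (g ⊗₁ g')
        α-natural : ∀ {A B D A' B' D'} (f : A ⇒ A') (g : B ⇒ B') (h : D ⇒ D') →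
                    (((f ⊗₁ g) ⊗₁ h) ⨾ α A' B' D') ≈ (α A B D ⨾ (f ⊗₁ (g ⊗₁ h)))
        α-isoˡ   : ∀ A B D → (α A B D ⨾ α⁻¹ A B D) ≈ id
        α-isoʳ   : ∀ A B D → (α⁻¹ A B D ⨾ α A B D) ≈ id
        unitorˡ-natural : ∀ {A B} (f : A ⇒ B) → ((id {unit} ⊗₁ f) ⨾ unitorˡ B) ≈ (unitorˡ A ⨾ f)
        unitorˡ-isoˡ : ∀ A → (unitorˡ A ⨾ unitorˡ⁻¹ A) ≈ id
        unitorˡ-isoʳ : ∀ A → (unitorˡ⁻¹ A ⨾ unitorˡ A) ≈ id
        unitorʳ-natural : ∀ {A B} (f : A ⇒ B) → ((f ⊗₁ id {unit}) ⨾ unitorʳ B) ≈ (unitorʳ A ⨾ f)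
        unitorʳ-isoˡ : ∀ A → (unitorʳ A ⨾ unitorʳ⁻¹ A) ≈ id
        unitorʳ-isoʳ : ∀ A → (unitorʳ⁻¹ A ⨾ unitorʳ A) ≈ id
        σ-natural : ∀ {A B A' B'} (f : A ⇒ A') (g : B ⇒ B') →
                    ((f ⊗₁ g) ⨾ σ A' B') ≈ (σ A B ⨾ (g ⊗₁ f))
        σ-involutive : ∀ A B → (σ A B ⨾ σ B A) ≈ id
        pentagon : ∀ A B D E →
          ((α A B D ⊗₁ id {E}) ⨾ α A (B ⊗₀ D) E ⨾ (id {A} ⊗₁ α B D E))
            ≈ (α (A ⊗₀ B) D E ⨾ α A B (D ⊗₀ E))
        triangle : ∀ A B → (α A unit B ⨾ (id {A} ⊗₁ unitorˡ B)) ≈ (unitorʳ A ⊗₁ id {B})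
        hexagon  : ∀ A B D →
          (α A B D ⨾ σ A (B ⊗₀ D) ⨾ α B D A)
            ≈ ((σ A B ⊗₁ id {D}) ⨾ α B A D ⨾ (id {B} ⊗₁ σ A D))

  module _ (Tn Pl : MonoidalData) where
    open MonoidalData Tn renaming (unit to I; α to α⊗; α⁻¹ to α⊗⁻¹;
      unitorˡ to λ⊗; unitorˡ⁻¹ to λ⊗⁻¹; unitorʳ to ρ⊗; unitorʳ⁻¹ to ρ⊗⁻¹; σ to σ⊗)
    open MonoidalData Pl renaming (_⊗₀_ to infixr 7 _⊕₀_; _⊗₁_ to infixr 7 _⊕₁_;
      unit to O; α to α⊕; α⁻¹ to α⊕⁻¹;
      unitorˡ to λ⊕; unitorˡ⁻¹ to λ⊕⁻¹; unitorʳ to ρ⊕; unitorʳ⁻¹ to ρ⊕⁻¹; σ to σ⊕)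

    record RigExtra : Set (o ⊔ ℓ) where
      field
        δl    : ∀ A B D → (A ⊗₀ (B ⊕₀ D)) ⇒ ((A ⊗₀ B) ⊕₀ (A ⊗₀ D))
        δl⁻¹  : ∀ A B D → ((A ⊗₀ B) ⊕₀ (A ⊗₀ D)) ⇒ (A ⊗₀ (B ⊕₀ D))
        δr    : ∀ A B D → ((A ⊕₀ B) ⊗₀ D) ⇒ ((A ⊗₀ D) ⊕₀ (B ⊗₀ D))
        δr⁻¹  : ∀ A B D → ((A ⊗₀ D) ⊕₀ (B ⊗₀ D)) ⇒ ((A ⊕₀ B) ⊗₀ D)
        annˡ   : ∀ A → (O ⊗₀ A) ⇒ O
        annˡ⁻¹ : ∀ A → O ⇒ (O ⊗₀ A)
        annʳ   : ∀ A → (A ⊗₀ O) ⇒ O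
        annʳ⁻¹ : ∀ A → O ⇒ (A ⊗₀ O)
        ∇     : ∀ A → (A ⊕₀ A) ⇒ A
        ¡     : ∀ A → O ⇒ A
        copy  : ∀ A → A ⇒ (A ⊗₀ A)
        disc  : ∀ A → A ⇒ I

    module _ (R : RigExtra) where
      open RigExtra R

      record IsFcCdRig : Set (o ⊔ ℓ ⊔ e) where
        field
          isCategory : IsCategory
          ⊗-symmetricMonoidal : IsSymmetricMonoidal Tn
          ⊕-symmetricMonoidal : IsSymmetricMonoidal Pl
          δl-natural : ∀ {A B D A' B' D'} (f : A ⇒ A') (g : B ⇒ B') (h : D ⇒ D') →
            ((f ⊗₁ (g ⊕₁ h)) ⨾ δl A' B' D') ≈ (δl A B D ⨾ ((f ⊗₁ g) ⊕₁ (f ⊗₁ h)))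
          δl-isoˡ : ∀ A B D → (δl A B D ⨾ δl⁻¹ A B D) ≈ id
          δl-isoʳ : ∀ A B D → (δl⁻¹ A B D ⨾ δl A B D) ≈ id
          δr-natural : ∀ {A B D A' B' D'} (f : A ⇒ A') (g : B ⇒ B') (h : D ⇒ D') →
            (((f ⊕₁ g) ⊗₁ h) ⨾ δr A' B' D') ≈ (δr A B D ⨾ ((f ⊗₁ h) ⊕₁ (g ⊗₁ h)))
          δr-isoˡ : ∀ A B D → (δr A B D ⨾ δr⁻¹ A B D) ≈ id
          δr-isoʳ : ∀ A B D → (δr⁻¹ A B D ⨾ δr A B D) ≈ id
          annˡ-natural : ∀ {A B} (f : A ⇒ B) → ((id {O} ⊗₁ f) ⨾ annˡ B) ≈ annˡ A
          annˡ-isoˡ : ∀ A → (annˡ A ⨾ annˡ⁻¹ A) ≈ id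
          annˡ-isoʳ : ∀ A → (annˡ⁻¹ A ⨾ annˡ A) ≈ id
          annʳ-natural : ∀ {A B} (f : A ⇒ B) → ((f ⊗₁ id {O}) ⨾ annʳ B) ≈ annʳ A
          annʳ-isoˡ : ∀ A → (annʳ A ⨾ annʳ⁻¹ A) ≈ id
          annʳ-isoʳ : ∀ A → (annʳ⁻¹ A ⨾ annʳ A) ≈ id
          laplaza-I : ∀ A B D →
            (δl A B D ⨾ σ⊕ (A ⊗₀ B) (A ⊗₀ D)) ≈ ((id {A} ⊗₁ σ⊕ B D) ⨾ δl A D B)
          laplaza-II : ∀ A B D →
            (δr A B D ⨾ σ⊕ (A ⊗₀ D) (B ⊗₀ D)) ≈ ((σ⊕ A B ⊗₁ id {D}) ⨾ δr B A D)
          laplaza-III : ∀ A B D →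
            (σ⊗ (A ⊕₀ B) D ⨾ δl D A B ⨾ (σ⊗ D A ⊕₁ σ⊗ D B)) ≈ δr A B D
          laplaza-IV : ∀ A B D E →
            (δl A B (D ⊕₀ E) ⨾ (id {A ⊗₀ B} ⊕₁ δl A D E) ⨾ α⊕⁻¹ (A ⊗₀ B) (A ⊗₀ D) (A ⊗₀ E))
              ≈ ((id {A} ⊗₁ α⊕⁻¹ B D E) ⨾ δl A (B ⊕₀ D) E ⨾ (δl A B D ⊕₁ id {A ⊗₀ E}))
          laplaza-V : ∀ A B D E →
            (δr (A ⊕₀ B) D E ⨾ (δr A B E ⊕₁ id {D ⊗₀ E}) ⨾ α⊕ (A ⊗₀ E) (B ⊗₀ E) (D ⊗₀ E))
              ≈ ((α⊕ A B D ⊗₁ id {E}) ⨾ δr A (B ⊕₀ D) E ⨾ (id {A ⊗₀ E} ⊕₁ δr B D E))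
          laplaza-VI : ∀ A B D E →
            ((id {A} ⊗₁ δl B D E) ⨾ δl A (B ⊗₀ D) (B ⊗₀ E) ⨾ (α⊗⁻¹ A B D ⊕₁ α⊗⁻¹ A B E))
              ≈ (α⊗⁻¹ A B (D ⊕₀ E) ⨾ δl (A ⊗₀ B) D E)
          laplaza-VII : ∀ A B D E →
            ((id {A} ⊗₁ δr B D E) ⨾ δl A (B ⊗₀ E) (D ⊗₀ E) ⨾ (α⊗⁻¹ A B E ⊕₁ α⊗⁻¹ A D E))
              ≈ (α⊗⁻¹ A (B ⊕₀ D) E ⨾ (δl A B D ⊗₁ id {E}) ⨾ δr (A ⊗₀ B) (A ⊗₀ D) E)
          laplaza-VIII : ∀ A B D E →
            (α⊗⁻¹ (A ⊕₀ B) D E ⨾ (δr A B D ⊗₁ id {E}) ⨾ δr (A ⊗₀ D) (B ⊗₀ D) E)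
              ≈ (δr A B (D ⊗₀ E) ⨾ (α⊗⁻¹ A D E ⊕₁ α⊗⁻¹ B D E))
          laplaza-IX : ∀ A B D E →
            (δr A B (D ⊕₀ E) ⨾ (δl A D E ⊕₁ δl B D E)
              ⨾ interchange Pl (A ⊗₀ D) (A ⊗₀ E) (B ⊗₀ D) (B ⊗₀ E))
              ≈ (δl (A ⊕₀ B) D E ⨾ (δr A B D ⊕₁ δr A B E))
          laplaza-X : annˡ O ≈ annʳ O
          laplaza-XI : ∀ A B →
            (δl O A B ⨾ (annˡ A ⊕₁ annˡ B) ⨾ λ⊕ O) ≈ annˡ (A ⊕₀ B)
          laplaza-XII : ∀ A B →
            (δr A B O ⨾ (annʳ A ⊕₁ annʳ B) ⨾ λ⊕ O) ≈ annʳ (A ⊕₀ B)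
          laplaza-XIII : annˡ I ≈ ρ⊗ O
          laplaza-XIV : annʳ I ≈ λ⊗ O
          laplaza-XV : ∀ A → (σ⊗ A O ⨾ annˡ A) ≈ annʳ A
          laplaza-XVI : ∀ A B →
            (α⊗⁻¹ O A B ⨾ (annˡ A ⊗₁ id {B}) ⨾ annˡ B) ≈ annˡ (A ⊗₀ B)
          laplaza-XVII : ∀ A B →
            (α⊗⁻¹ A O B ⨾ (annʳ A ⊗₁ id {B}) ⨾ annˡ B) ≈ ((id {A} ⊗₁ annˡ B) ⨾ annʳ A)
          laplaza-XVIII : ∀ A B →
            (α⊗⁻¹ A B O ⨾ annʳ (A ⊗₀ B)) ≈ ((id {A} ⊗₁ annʳ B) ⨾ annʳ A)
          laplaza-XIX : ∀ A B →
            (δl A O B ⨾ (annʳ A ⊕₁ id {A ⊗₀ B}) ⨾ λ⊕ (A ⊗₀ B)) ≈ (id {A} ⊗₁ λ⊕ B)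
          laplaza-XX : ∀ A B →
            (δr O A B ⨾ (annˡ B ⊕₁ id {A ⊗₀ B}) ⨾ λ⊕ (A ⊗₀ B)) ≈ (λ⊕ A ⊗₁ id {B})
          laplaza-XXI : ∀ A B →
            (δl A B O ⨾ (id {A ⊗₀ B} ⊕₁ annʳ A) ⨾ ρ⊕ (A ⊗₀ B)) ≈ (id {A} ⊗₁ ρ⊕ B)
          laplaza-XXII : ∀ A B →
            (δr A O B ⨾ (id {A ⊗₀ B} ⊕₁ annˡ B) ⨾ ρ⊕ (A ⊗₀ B)) ≈ (ρ⊕ A ⊗₁ id {B})
          laplaza-XXIII : ∀ A B → (δl I A B ⨾ (λ⊗ A ⊕₁ λ⊗ B)) ≈ λ⊗ (A ⊕₀ B)
          laplaza-XXIV : ∀ A B → (δr A B I ⨾ (ρ⊗ A ⊕₁ ρ⊗ B)) ≈ ρ⊗ (A ⊕₀ B)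
          ∇-natural : ∀ {A B} (f : A ⇒ B) → ((f ⊕₁ f) ⨾ ∇ B) ≈ (∇ A ⨾ f)
          ¡-natural : ∀ {A B} (f : A ⇒ B) → (¡ A ⨾ f) ≈ ¡ B
          ∇-assoc : ∀ A → ((∇ A ⊕₁ id {A}) ⨾ ∇ A) ≈ (α⊕ A A A ⨾ (id {A} ⊕₁ ∇ A) ⨾ ∇ A)
          ∇-unitˡ : ∀ A → ((¡ A ⊕₁ id {A}) ⨾ ∇ A) ≈ λ⊕ A
          ∇-unitʳ : ∀ A → ((id {A} ⊕₁ ¡ A) ⨾ ∇ A) ≈ ρ⊕ A
          ∇-comm  : ∀ A → (σ⊕ A A ⨾ ∇ A) ≈ ∇ A
          ∇-coh-⊕ : ∀ A B → ∇ (A ⊕₀ B) ≈ (interchange Pl A B A B ⨾ (∇ A ⊕₁ ∇ B))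
          ¡-coh-⊕ : ∀ A B → ¡ (A ⊕₀ B) ≈ (λ⊕⁻¹ O ⨾ (¡ A ⊕₁ ¡ B))
          ∇-coh-O : ∇ O ≈ λ⊕ O
          ¡-coh-O : ¡ O ≈ id
          copy-coassoc : ∀ A →
            (copy A ⨾ (copy A ⊗₁ id {A}) ⨾ α⊗ A A A) ≈ (copy A ⨾ (id {A} ⊗₁ copy A))
          copy-counitˡ : ∀ A → (copy A ⨾ (disc A ⊗₁ id {A}) ⨾ λ⊗ A) ≈ id
          copy-counitʳ : ∀ A → (copy A ⨾ (id {A} ⊗₁ disc A) ⨾ ρ⊗ A) ≈ id
          copy-cocomm  : ∀ A → (copy A ⨾ σ⊗ A A) ≈ copy A
          copy-coh-⊗ : ∀ A B → copy (A ⊗₀ B) ≈ ((copy A ⊗₁ copy B) ⨾ interchange Tn A A B B)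
          disc-coh-⊗ : ∀ A B → disc (A ⊗₀ B) ≈ ((disc A ⊗₁ disc B) ⨾ λ⊗ I)
          copy-coh-I : copy I ≈ λ⊗⁻¹ I
          disc-coh-I : disc I ≈ id
          disc-coh-⊕ : ∀ A B → disc (A ⊕₀ B) ≈ ((disc A ⊕₁ disc B) ⨾ ∇ I)
          copy-coh-⊕ : ∀ A B → copy (A ⊕₀ B) ≈
            ((ρ⊕⁻¹ A ⊕₁ λ⊕⁻¹ B)
             ⨾ ((copy A ⊕₁ ¡ (A ⊗₀ B)) ⊕₁ (¡ (B ⊗₀ A) ⊕₁ copy B))
             ⨾ (δl⁻¹ A A B ⊕₁ δl⁻¹ B A B)
             ⨾ δr⁻¹ A B (A ⊕₀ B))

  module _ (Tn : MonoidalData) where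
    open MonoidalData Tn renaming (unit to I; α to α⊗; α⁻¹ to α⊗⁻¹;
      unitorˡ to λ⊗; unitorˡ⁻¹ to λ⊗⁻¹; unitorʳ to ρ⊗; unitorʳ⁻¹ to ρ⊗⁻¹; σ to σ⊗)

    record SymMonMonad : Set (o ⊔ ℓ ⊔ e) where
      field
        T₀ : Obj → Obj
        T₁ : ∀ {A B} → A ⇒ B → T₀ A ⇒ T₀ B
        η  : ∀ A → A ⇒ T₀ A
        μ  : ∀ A → T₀ (T₀ A) ⇒ T₀ A
        m  : ∀ A B → (T₀ A ⊗₀ T₀ B) ⇒ T₀ (A ⊗₀ B)
        m₀ : I ⇒ T₀ I
        T-id     : ∀ {A} → T₁ (id {A}) ≈ id
        T-comp   : ∀ {A B D} (f : A ⇒ B) (g : B ⇒ D) → T₁ (f ⨾ g) ≈ (T₁ f ⨾ T₁ g)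
        T-resp-≈ : ∀ {A B} {f g : A ⇒ B} → f ≈ g → T₁ f ≈ T₁ g
        η-natural : ∀ {A B} (f : A ⇒ B) → (f ⨾ η B) ≈ (η A ⨾ T₁ f)
        μ-natural : ∀ {A B} (f : A ⇒ B) → (T₁ (T₁ f) ⨾ μ B) ≈ (μ A ⨾ T₁ f)
        μ-unitˡ   : ∀ A → (η (T₀ A) ⨾ μ A) ≈ id
        μ-unitʳ   : ∀ A → (T₁ (η A) ⨾ μ A) ≈ id
        μ-assoc   : ∀ A → (T₁ (μ A) ⨾ μ A) ≈ (μ (T₀ A) ⨾ μ A)
        m-natural : ∀ {A B A' B'} (f : A ⇒ A') (g : B ⇒ B') →
                    ((T₁ f ⊗₁ T₁ g) ⨾ m A' B') ≈ (m A B ⨾ T₁ (f ⊗₁ g))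
        m-assoc   : ∀ A B D →
          ((m A B ⊗₁ id {T₀ D}) ⨾ m (A ⊗₀ B) D ⨾ T₁ (α⊗ A B D))
            ≈ (α⊗ (T₀ A) (T₀ B) (T₀ D) ⨾ (id {T₀ A} ⊗₁ m B D) ⨾ m A (B ⊗₀ D))
        m-unitˡ   : ∀ A → ((m₀ ⊗₁ id {T₀ A}) ⨾ m I A ⨾ T₁ (λ⊗ A)) ≈ λ⊗ (T₀ A)
        m-unitʳ   : ∀ A → ((id {T₀ A} ⊗₁ m₀) ⨾ m A I ⨾ T₁ (ρ⊗ A)) ≈ ρ⊗ (T₀ A)
        m-symm    : ∀ A B → (m A B ⨾ T₁ (σ⊗ A B)) ≈ (σ⊗ (T₀ A) (T₀ B) ⨾ m B A)
        η-monoidal  : ∀ A B → ((η A ⊗₁ η B) ⨾ m A B) ≈ η (A ⊗₀ B)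
        η-monoidal₀ : η I ≈ m₀
        μ-monoidal  : ∀ A B →
          ((μ A ⊗₁ μ B) ⨾ m A B) ≈ (m (T₀ A) (T₀ B) ⨾ T₁ (m A B) ⨾ μ (A ⊗₀ B))
        μ-monoidal₀ : (m₀ ⨾ T₁ m₀ ⨾ μ I) ≈ m₀

module _ {o ℓ e} (C : Cat o ℓ e) (Tn : MonoidalData C) (M : SymMonMonad C Tn) where
  open Cat C
  open MonoidalData Tn
  open SymMonMonad M

  Kleisli : Cat o ℓ e
  Kleisli = record
    { Obj = Obj
    ; _⇒_ = λ A B → A ⇒ T₀ B
    ; _≈_ = _≈_
    ; id  = λ {A} → η A
    ; _⨾_ = λ {A} {B} {D} f g → f ⨾ T₁ g ⨾ μ D
    }

  𝒦 : ∀ {A B} → A ⇒ B → A ⇒ T₀ B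
  𝒦 {B = B} f = f ⨾ η B

  KleisliTensor : MonoidalData Kleisli
  KleisliTensor = record
    { _⊗₀_ = _⊗₀_
    ; _⊗₁_ = λ {A} {B} {A'} {B'} f g → (f ⊗₁ g) ⨾ m A' B'
    ; unit = unit
    ; α    = λ A B D → 𝒦 (α A B D)
    ; α⁻¹  = λ A B D → 𝒦 (α⁻¹ A B D)
    ; unitorˡ   = λ A → 𝒦 (unitorˡ A)
    ; unitorˡ⁻¹ = λ A → 𝒦 (unitorˡ⁻¹ A)
    ; unitorʳ   = λ A → 𝒦 (unitorʳ A)
    ; unitorʳ⁻¹ = λ A → 𝒦 (unitorʳ⁻¹ A)
    ; σ    = λ A B → 𝒦 (σ A B)
    }

  module _ (Pl : MonoidalData C) (R : RigExtra C Tn Pl) where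
    open RigExtra R
    open MonoidalData Pl renaming (_⊗₀_ to _⊕₀_; _⊗₁_ to _⊕₁_;
      unit to O; α to α⊕; α⁻¹ to α⊕⁻¹;
      unitorˡ to λ⊕; unitorˡ⁻¹ to λ⊕⁻¹; unitorʳ to ρ⊕; unitorʳ⁻¹ to ρ⊕⁻¹; σ to σ⊕)

    -- coproduct injections in C (⊕ is a coproduct in an fc category)
    ι₁ : ∀ A B → A ⇒ (A ⊕₀ B)
    ι₁ A B = ρ⊕⁻¹ A ⨾ (id {A} ⊕₁ ¡ B)

    ι₂ : ∀ A B → B ⇒ (A ⊕₀ B)
    ι₂ A B = λ⊕⁻¹ B ⨾ (¡ A ⊕₁ id {B})

    -- ⊕ on Kleisli arrows: the copairing [f ⨾ T ι₁ , g ⨾ T ι₂] (the coproduct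
    -- of C_T induced by 𝒦); on objects and on 𝒦-images it agrees with ⊕.
    KleisliPlus : MonoidalData Kleisli
    KleisliPlus = record
      { _⊗₀_ = _⊕₀_
      ; _⊗₁_ = λ {A} {B} {A'} {B'} f g →
                 ((f ⨾ T₁ (ι₁ A' B')) ⊕₁ (g ⨾ T₁ (ι₂ A' B'))) ⨾ ∇ (T₀ (A' ⊕₀ B'))
      ; unit = O
      ; α    = λ A B D → 𝒦 (α⊕ A B D)
      ; α⁻¹  = λ A B D → 𝒦 (α⊕⁻¹ A B D)
      ; unitorˡ   = λ A → 𝒦 (λ⊕ A)
      ; unitorˡ⁻¹ = λ A → 𝒦 (λ⊕⁻¹ A)
      ; unitorʳ   = λ A → 𝒦 (ρ⊕ A)
      ; unitorʳ⁻¹ = λ A → 𝒦 (ρ⊕⁻¹ A)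
      ; σ    = λ A B → 𝒦 (σ⊕ A B)
      }

    KleisliRig : RigExtra Kleisli KleisliTensor KleisliPlus
    KleisliRig = record
      { δl     = λ A B D → 𝒦 (δl A B D)
      ; δl⁻¹   = λ A B D → 𝒦 (δl⁻¹ A B D)
      ; δr     = λ A B D → 𝒦 (δr A B D)
      ; δr⁻¹   = λ A B D → 𝒦 (δr⁻¹ A B D)
      ; annˡ   = λ A → 𝒦 (annˡ A)
      ; annˡ⁻¹ = λ A → 𝒦 (annˡ⁻¹ A)
      ; annʳ   = λ A → 𝒦 (annʳ A)
      ; annʳ⁻¹ = λ A → 𝒦 (annʳ⁻¹ A)
      ; ∇      = λ A → 𝒦 (∇ A)
      ; ¡      = λ A → 𝒦 (¡ A)
      ; copy   = λ A → copy A ⨾ η (A ⊗₀ A)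
      ; disc   = λ A → disc A ⨾ η unit
      }

-- The canonical functor 𝒦 : C → C_T is the identity on objects and, T being a symmetric
-- monoidal monad, strictly preserves composition, ⊗ (𝒦 f ⊗_T 𝒦 g = 𝒦 (f ⊗ g) as η is monoidal)
-- and ⊕. Every structural map of C_T is a 𝒦-image, so each coherence axiom, an equation between
-- composites of structural maps, transfers from C. What remains is naturality for arbitrary
-- Kleisli arrows. For ⊗ it follows from naturality and monoidality of m, η and μ. For ⊕ one uses
-- that in an fc category ⊕ is a coproduct, with injections built from ¡ and the unitors and
-- copairing [ f , g ] = (f ⊕ g) ⨾ ∇; the Kleisli sum f ⊕_T g is [ f ⨾ T ι₁ , g ⨾ T ι₂ ], so
-- naturality reduces to how structural maps act on injections, and the distributors carry
-- injections to injections by Laplaza's axioms (XXI), (I) and (III).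

module Submission where

open import Level using (_⊔_)
open import Relation.Binary using (Setoid)
import Relation.Binary.Reasoning.Setoid as SetoidReasoning
open import Defs hiding (𝒦; ι₁; ι₂)

module CategoryReasoning {o ℓ e} (C : Cat o ℓ e) (isCategory : IsCategory C) where
  open Cat C
  open IsCategory isCategory using (equiv; ⨾-resp-≈)

  homSetoid : Obj → Obj → Setoid ℓ e
  homSetoid A B = record { Carrier = A ⇒ B ; _≈_ = _≈_ ; isEquivalence = equiv }

  module _ {A B : Obj} where
    open Setoid (homSetoid A B) public using (refl; sym; trans)
    open SetoidReasoning (homSetoid A B) public

  private variable
    A B D E X Y : Obj

  infixr 6 _⟩⨾⟨_ refl⟩⨾⟨_
  infixl 7 _⟩⨾⟨refl

  _⟩⨾⟨_ : ∀ {f f' : A ⇒ B} {g g' : B ⇒ D} → f ≈ f' → g ≈ g' → f ⨾ g ≈ f' ⨾ g'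
  _⟩⨾⟨_ = ⨾-resp-≈

  refl⟩⨾⟨_ : ∀ {f : A ⇒ B} {g g' : B ⇒ D} → g ≈ g' → f ⨾ g ≈ f ⨾ g'
  refl⟩⨾⟨ p = refl ⟩⨾⟨ p

  _⟩⨾⟨refl : ∀ {f f' : A ⇒ B} {g : B ⇒ D} → f ≈ f' → f ⨾ g ≈ f' ⨾ g
  p ⟩⨾⟨refl = p ⟩⨾⟨ refl

  identityˡ : ∀ {f : A ⇒ B} → id ⨾ f ≈ f
  identityˡ = IsCategory.identityˡ isCategory _

  identityʳ : ∀ {f : A ⇒ B} → f ⨾ id ≈ f
  identityʳ = IsCategory.identityʳ isCategory _

  assoc : ∀ {f : A ⇒ B} {g : B ⇒ D} {h : D ⇒ E} → (f ⨾ g) ⨾ h ≈ f ⨾ (g ⨾ h)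
  assoc = IsCategory.assoc isCategory _ _ _

  sym-assoc : ∀ {f : A ⇒ B} {g : B ⇒ D} {h : D ⇒ E} → f ⨾ (g ⨾ h) ≈ (f ⨾ g) ⨾ h
  sym-assoc = sym assoc

  pullˡ : ∀ {f : A ⇒ B} {g : B ⇒ D} {h : A ⇒ D} {k : D ⇒ E} → f ⨾ g ≈ h → f ⨾ (g ⨾ k) ≈ h ⨾ k
  pullˡ p = trans sym-assoc (p ⟩⨾⟨refl)

  pushˡ : ∀ {f : A ⇒ B} {g : B ⇒ D} {h : A ⇒ D} {k : D ⇒ E} → h ≈ f ⨾ g → h ⨾ k ≈ f ⨾ (g ⨾ k)
  pushˡ p = sym (pullˡ (sym p))

  cancelˡ : ∀ {f : A ⇒ B} {g : B ⇒ A} {k : A ⇒ D} → f ⨾ g ≈ id → f ⨾ (g ⨾ k) ≈ k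
  cancelˡ p = trans (pullˡ p) identityˡ

  slide : ∀ {x : A ⇒ B} {s : B ⇒ D} {s' : A ⇒ X} {y : X ⇒ D} {r : D ⇒ E} →
          x ⨾ s ≈ s' ⨾ y → x ⨾ (s ⨾ r) ≈ s' ⨾ (y ⨾ r)
  slide p = trans (pullˡ p) assoc

  glue : ∀ {x : A ⇒ B} {s : B ⇒ D} {s' : A ⇒ X} {y : X ⇒ D} {r : D ⇒ E} {r' : X ⇒ Y} {z : Y ⇒ E} →
         x ⨾ s ≈ s' ⨾ y → y ⨾ r ≈ r' ⨾ z → x ⨾ (s ⨾ r) ≈ (s' ⨾ r') ⨾ z
  glue p q = trans (slide p) (trans (refl⟩⨾⟨ q) sym-assoc)

  move-isoʳ : ∀ {f : A ⇒ B} {u : B ⇒ D} {g : A ⇒ D} {u' : D ⇒ B} →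
              f ⨾ u ≈ g → u ⨾ u' ≈ id → f ≈ g ⨾ u'
  move-isoʳ p q = trans (sym identityʳ) (trans (refl⟩⨾⟨ sym q) (pullˡ p))

  invert-square : ∀ {s : A ⇒ B} {s' : B ⇒ A} {x : A ⇒ X} {y : B ⇒ Y} {t : X ⇒ Y} {t' : Y ⇒ X} →
                  s' ⨾ s ≈ id → t ⨾ t' ≈ id → x ⨾ t ≈ s ⨾ y → y ⨾ t' ≈ s' ⨾ x
  invert-square {s = s} {s'} {x} {y} {t} {t'} p q r = begin
    y ⨾ t'               ≈⟨ cancelˡ p ⟨
    s' ⨾ (s ⨾ (y ⨾ t'))  ≈⟨ refl⟩⨾⟨ trans sym-assoc (sym (pullˡ r)) ⟩
    s' ⨾ (x ⨾ (t ⨾ t'))  ≈⟨ refl⟩⨾⟨ refl⟩⨾⟨ q ⟩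
    s' ⨾ (x ⨾ id)        ≈⟨ refl⟩⨾⟨ identityʳ ⟩
    s' ⨾ x               ∎

  ⨾-inverse : ∀ {x : A ⇒ B} {x' : B ⇒ A} {y : B ⇒ D} {y' : D ⇒ B} →
              x ⨾ x' ≈ id → y ⨾ y' ≈ id → (x ⨾ y) ⨾ (y' ⨾ x') ≈ id
  ⨾-inverse p q = trans assoc (trans (refl⟩⨾⟨ cancelˡ q) p)

module MonoidalReasoning {o ℓ e} (C : Cat o ℓ e) (isCategory : IsCategory C)
  (N : MonoidalData C) (isSymmetricMonoidal : IsSymmetricMonoidal C N) where
  open Cat C
  open CategoryReasoning C isCategory
  open MonoidalData N
  open IsSymmetricMonoidal isSymmetricMonoidal public

  private variable
    A B D A' B' D' : Obj

  ⊗-⨾ : ∀ {f : A ⇒ B} {g : B ⇒ D} {f' : A' ⇒ B'} {g' : B' ⇒ D'} →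
        (f ⨾ g) ⊗₁ (f' ⨾ g') ≈ (f ⊗₁ f') ⨾ (g ⊗₁ g')
  ⊗-⨾ = ⊗-comp _ _ _ _

  ⊗-⨾-⊗id : ∀ {f : A ⇒ B} {g : B ⇒ D} {h : A' ⇒ B'} → (f ⨾ g) ⊗₁ h ≈ (f ⊗₁ h) ⨾ (g ⊗₁ id)
  ⊗-⨾-⊗id = trans (⊗-resp-≈ refl (sym identityʳ)) ⊗-⨾

  ⊗-⨾-id⊗ : ∀ {f : A ⇒ B} {g : A' ⇒ B'} {h : B' ⇒ D'} → f ⊗₁ (g ⨾ h) ≈ (f ⊗₁ g) ⨾ (id ⊗₁ h)
  ⊗-⨾-id⊗ = trans (⊗-resp-≈ (sym identityʳ) refl) ⊗-⨾

  ⊗-inverse : ∀ {x : A ⇒ A'} {x' : A' ⇒ A} {y : B ⇒ B'} {y' : B' ⇒ B} →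
              x ⨾ x' ≈ id → y ⨾ y' ≈ id → (x ⊗₁ y) ⨾ (x' ⊗₁ y') ≈ id
  ⊗-inverse p q = trans (sym ⊗-⨾) (trans (⊗-resp-≈ p q) ⊗-id)

  α⁻¹-natural : ∀ (f : A ⇒ A') (g : B ⇒ B') (h : D ⇒ D') →
                (f ⊗₁ (g ⊗₁ h)) ⨾ α⁻¹ A' B' D' ≈ α⁻¹ A B D ⨾ ((f ⊗₁ g) ⊗₁ h)
  α⁻¹-natural f g h = invert-square (α-isoʳ _ _ _) (α-isoˡ _ _ _) (α-natural f g h)

  interchange-natural : ∀ {W X Y Z W' X' Y' Z'} (a : W ⇒ W') (b : X ⇒ X') (c : Y ⇒ Y') (d : Z ⇒ Z') →
    ((a ⊗₁ b) ⊗₁ (c ⊗₁ d)) ⨾ interchange C N W' X' Y' Z'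
      ≈ interchange C N W X Y Z ⨾ ((a ⊗₁ c) ⊗₁ (b ⊗₁ d))
  interchange-natural a b c d =
    glue (α-natural _ _ _)
      (glue (id⊗-slide (α⁻¹-natural _ _ _))
        (glue (id⊗-slide (⊗id-slide (σ-natural _ _)))
          (glue (id⊗-slide (α-natural _ _ _)) (α⁻¹-natural _ _ _))))
    where
    id⊗-slide : ∀ {A A' B B' B'' E} {a : A ⇒ A'} {x : B ⇒ B'} {y : B' ⇒ B''} {y' : B ⇒ E} {x' : E ⇒ B''} →
                x ⨾ y ≈ y' ⨾ x' → (a ⊗₁ x) ⨾ (id ⊗₁ y) ≈ (id ⊗₁ y') ⨾ (a ⊗₁ x')
    id⊗-slide p = trans (sym ⊗-⨾) (trans (⊗-resp-≈ (trans identityʳ (sym identityˡ)) p) ⊗-⨾)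
    ⊗id-slide : ∀ {A A' B B' B'' E} {a : A ⇒ A'} {x : B ⇒ B'} {y : B' ⇒ B''} {y' : B ⇒ E} {x' : E ⇒ B''} →
                x ⨾ y ≈ y' ⨾ x' → (x ⊗₁ a) ⨾ (y ⊗₁ id) ≈ (y' ⊗₁ id) ⨾ (x' ⊗₁ a)
    ⊗id-slide p = trans (sym ⊗-⨾) (trans (⊗-resp-≈ p (trans identityʳ (sym identityˡ))) ⊗-⨾)

module KleisliCategory {o ℓ e} (C : Cat o ℓ e) (isCategory : IsCategory C)
  (Tn : MonoidalData C) (⊗-symmetricMonoidal : IsSymmetricMonoidal C Tn) (M : SymMonMonad C Tn) where
  open Cat C
  open MonoidalData Tn
  open SymMonMonad M
  open CategoryReasoning C isCategory
  open MonoidalReasoning C isCategory Tn ⊗-symmetricMonoidal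
  open Cat (Kleisli C Tn M) public using () renaming (_⨾_ to infixr 5 _⨾ₖ_)
  open MonoidalData (KleisliTensor C Tn M) public using () renaming (_⊗₁_ to infixr 8 _⊗ₖ_)

  private variable
    A B D E X A' B' D' : Obj

  𝒦 : A ⇒ B → A ⇒ T₀ B
  𝒦 = Defs.𝒦 C Tn M

  ⨾ₖ-resp : ∀ {f f' : A ⇒ T₀ B} {g g' : B ⇒ T₀ D} → f ≈ f' → g ≈ g' → f ⨾ₖ g ≈ f' ⨾ₖ g'
  ⨾ₖ-resp p q = p ⟩⨾⟨ T-resp-≈ q ⟩⨾⟨refl

  ⨾ₖ-identityˡ : ∀ {f : A ⇒ T₀ B} → η A ⨾ₖ f ≈ f
  ⨾ₖ-identityˡ = trans (pullˡ (sym (η-natural _))) (trans assoc (trans (refl⟩⨾⟨ μ-unitˡ _) identityʳ))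

  ⨾ₖ-identityʳ : ∀ {f : A ⇒ T₀ B} → f ⨾ₖ η B ≈ f
  ⨾ₖ-identityʳ = trans (refl⟩⨾⟨ μ-unitʳ _) identityʳ

  ⨾ₖ-assoc : ∀ {f : A ⇒ T₀ B} {g : B ⇒ T₀ D} {h : D ⇒ T₀ E} → (f ⨾ₖ g) ⨾ₖ h ≈ f ⨾ₖ (g ⨾ₖ h)
  ⨾ₖ-assoc {f = f} {g} {h} = begin
    (f ⨾ T₁ g ⨾ μ _) ⨾ T₁ h ⨾ μ _          ≈⟨ trans assoc (refl⟩⨾⟨ assoc) ⟩
    f ⨾ T₁ g ⨾ μ _ ⨾ T₁ h ⨾ μ _            ≈⟨ refl⟩⨾⟨ refl⟩⨾⟨ pullˡ (sym (μ-natural h)) ⟩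
    f ⨾ T₁ g ⨾ (T₁ (T₁ h) ⨾ μ _) ⨾ μ _     ≈⟨ refl⟩⨾⟨ refl⟩⨾⟨ trans assoc (refl⟩⨾⟨ sym (μ-assoc _)) ⟩
    f ⨾ T₁ g ⨾ T₁ (T₁ h) ⨾ T₁ (μ _) ⨾ μ _  ≈⟨ refl⟩⨾⟨ trans (refl⟩⨾⟨ sym-assoc) sym-assoc ⟩
    f ⨾ (T₁ g ⨾ T₁ (T₁ h) ⨾ T₁ (μ _)) ⨾ μ _ ≈⟨ refl⟩⨾⟨ (trans (refl⟩⨾⟨ sym (T-comp _ _)) (sym (T-comp _ _))) ⟩⨾⟨refl ⟩
    f ⨾ T₁ (g ⨾ T₁ h ⨾ μ _) ⨾ μ _          ∎

  kleisli-isCategory : IsCategory (Kleisli C Tn M)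
  kleisli-isCategory = record
    { equiv     = IsCategory.equiv isCategory
    ; ⨾-resp-≈  = ⨾ₖ-resp
    ; identityˡ = λ _ → ⨾ₖ-identityˡ
    ; identityʳ = λ _ → ⨾ₖ-identityʳ
    ; assoc     = λ _ _ _ → ⨾ₖ-assoc
    }

  T₁-fuse : ∀ {x : X ⇒ T₀ A} {a : A ⇒ B} {b : B ⇒ D} → (x ⨾ T₁ a) ⨾ T₁ b ≈ x ⨾ T₁ (a ⨾ b)
  T₁-fuse = trans assoc (refl⟩⨾⟨ sym (T-comp _ _))

  T₁-id : ∀ {x : X ⇒ T₀ A} {a : A ⇒ A} → a ≈ id → x ⨾ T₁ a ≈ x
  T₁-id p = trans (refl⟩⨾⟨ trans (T-resp-≈ p) T-id) identityʳ

  T₁-⨾ₖ : ∀ {f : X ⇒ T₀ A} {j : A ⇒ B} {h : B ⇒ T₀ D} → (f ⨾ T₁ j) ⨾ₖ h ≈ f ⨾ₖ (j ⨾ h)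
  T₁-⨾ₖ = trans assoc (refl⟩⨾⟨ pullˡ (sym (T-comp _ _)))

  ⨾ₖ-T₁ : ∀ {f : X ⇒ T₀ A} {p : A ⇒ T₀ B} {k : B ⇒ D} → f ⨾ₖ (p ⨾ T₁ k) ≈ (f ⨾ₖ p) ⨾ T₁ k
  ⨾ₖ-T₁ {f = f} {p} {k} = begin
    f ⨾ T₁ (p ⨾ T₁ k) ⨾ μ _     ≈⟨ refl⟩⨾⟨ pushˡ (T-comp _ _) ⟩
    f ⨾ T₁ p ⨾ T₁ (T₁ k) ⨾ μ _  ≈⟨ refl⟩⨾⟨ refl⟩⨾⟨ μ-natural k ⟩
    f ⨾ T₁ p ⨾ μ _ ⨾ T₁ k       ≈⟨ trans (refl⟩⨾⟨ sym-assoc) sym-assoc ⟩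
    (f ⨾ T₁ p ⨾ μ _) ⨾ T₁ k     ∎

  ⨾ₖ-𝒦 : ∀ {f : A ⇒ T₀ B} {g : B ⇒ D} → f ⨾ₖ 𝒦 g ≈ f ⨾ T₁ g
  ⨾ₖ-𝒦 = refl⟩⨾⟨ trans (pushˡ (T-comp _ _)) (trans (refl⟩⨾⟨ μ-unitʳ _) identityʳ)

  𝒦-⨾ₖ : ∀ {f : A ⇒ B} {g : B ⇒ T₀ D} → 𝒦 f ⨾ₖ g ≈ f ⨾ g
  𝒦-⨾ₖ = trans assoc (refl⟩⨾⟨ ⨾ₖ-identityˡ)

  𝒦-T₁ : ∀ {f : A ⇒ B} {g : B ⇒ D} → 𝒦 f ⨾ T₁ g ≈ 𝒦 (f ⨾ g)
  𝒦-T₁ = trans assoc (trans (refl⟩⨾⟨ sym (η-natural _)) sym-assoc)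

  𝒦-identity : η A ≈ 𝒦 id
  𝒦-identity = sym identityˡ

  𝒦-homomorphism : ∀ {f : A ⇒ B} {g : B ⇒ D} → 𝒦 f ⨾ₖ 𝒦 g ≈ 𝒦 (f ⨾ g)
  𝒦-homomorphism = trans 𝒦-⨾ₖ sym-assoc

  ⊗ₖ-resp : ∀ {f f' : A ⇒ T₀ B} {g g' : A' ⇒ T₀ B'} → f ≈ f' → g ≈ g' → f ⊗ₖ g ≈ f' ⊗ₖ g'
  ⊗ₖ-resp p q = ⊗-resp-≈ p q ⟩⨾⟨refl

  ⊗ₖ-identity : η A ⊗ₖ η B ≈ η (A ⊗₀ B)
  ⊗ₖ-identity = η-monoidal _ _

  𝒦-⊗ : ∀ {f : A ⇒ B} {g : A' ⇒ B'} → 𝒦 f ⊗ₖ 𝒦 g ≈ 𝒦 (f ⊗₁ g)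
  𝒦-⊗ = trans (pushˡ ⊗-⨾) (refl⟩⨾⟨ η-monoidal _ _)

  ⊗ₖ-T₁ : ∀ {f : A ⇒ T₀ B} {a : B ⇒ D} {g : A' ⇒ T₀ B'} {b : B' ⇒ D'} →
          (f ⨾ T₁ a) ⊗ₖ (g ⨾ T₁ b) ≈ (f ⊗ₖ g) ⨾ T₁ (a ⊗₁ b)
  ⊗ₖ-T₁ = trans (pushˡ ⊗-⨾) (trans (refl⟩⨾⟨ m-natural _ _) sym-assoc)

  ⊗ₖ-homomorphism : ∀ (f : A ⇒ T₀ B) (g : B ⇒ T₀ D) (f' : A' ⇒ T₀ B') (g' : B' ⇒ T₀ D') →
                    (f ⨾ₖ g) ⊗ₖ (f' ⨾ₖ g') ≈ (f ⊗ₖ f') ⨾ₖ (g ⊗ₖ g')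
  ⊗ₖ-homomorphism f g f' g' = begin
    ((f ⨾ T₁ g ⨾ μ _) ⊗₁ (f' ⨾ T₁ g' ⨾ μ _)) ⨾ m _ _
      ≈⟨ trans (⊗-resp-≈ sym-assoc sym-assoc) ⊗-⨾ ⟩⨾⟨refl ⟩
    (((f ⨾ T₁ g) ⊗₁ (f' ⨾ T₁ g')) ⨾ (μ _ ⊗₁ μ _)) ⨾ m _ _
      ≈⟨ trans assoc (refl⟩⨾⟨ μ-monoidal _ _) ⟩
    ((f ⨾ T₁ g) ⊗₁ (f' ⨾ T₁ g')) ⨾ m _ _ ⨾ T₁ (m _ _) ⨾ μ _
      ≈⟨ pullˡ ⊗ₖ-T₁ ⟩
    ((f ⊗ₖ f') ⨾ T₁ (g ⊗₁ g')) ⨾ T₁ (m _ _) ⨾ μ _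
      ≈⟨ trans sym-assoc (trans (T₁-fuse ⟩⨾⟨refl) assoc) ⟩
    (f ⊗ₖ f') ⨾ T₁ ((g ⊗₁ g') ⨾ m _ _) ⨾ μ _
      ∎

  ⊗ₖ-α-natural : ∀ (f : A ⇒ T₀ A') (g : B ⇒ T₀ B') (h : D ⇒ T₀ D') →
                 ((f ⊗ₖ g) ⊗ₖ h) ⨾ₖ 𝒦 (α A' B' D') ≈ 𝒦 (α A B D) ⨾ₖ (f ⊗ₖ (g ⊗ₖ h))
  ⊗ₖ-α-natural f g h = begin
    ((f ⊗ₖ g) ⊗ₖ h) ⨾ₖ 𝒦 (α _ _ _)                      ≈⟨ ⨾ₖ-𝒦 ⟩
    ((((f ⊗₁ g) ⨾ m _ _) ⊗₁ h) ⨾ m _ _) ⨾ T₁ (α _ _ _)  ≈⟨ trans assoc (⊗-⨾-⊗id ⟩⨾⟨refl) ⟩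
    (((f ⊗₁ g) ⊗₁ h) ⨾ (m _ _ ⊗₁ id)) ⨾ m _ _ ⨾ T₁ (α _ _ _)
                                                        ≈⟨ trans assoc (refl⟩⨾⟨ m-assoc _ _ _) ⟩
    ((f ⊗₁ g) ⊗₁ h) ⨾ α _ _ _ ⨾ (id ⊗₁ m _ _) ⨾ m _ _  ≈⟨ slide (α-natural _ _ _) ⟩
    α _ _ _ ⨾ (f ⊗₁ (g ⊗₁ h)) ⨾ (id ⊗₁ m _ _) ⨾ m _ _  ≈⟨ refl⟩⨾⟨ pullˡ (sym ⊗-⨾-id⊗) ⟩
    α _ _ _ ⨾ (f ⊗ₖ (g ⊗ₖ h))                           ≈⟨ 𝒦-⨾ₖ ⟨
    𝒦 (α _ _ _) ⨾ₖ (f ⊗ₖ (g ⊗ₖ h))                      ∎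

  ⊗ₖ-λ-natural : ∀ (f : A ⇒ T₀ B) → (η unit ⊗ₖ f) ⨾ₖ 𝒦 (unitorˡ B) ≈ 𝒦 (unitorˡ A) ⨾ₖ f
  ⊗ₖ-λ-natural f = begin
    (η unit ⊗ₖ f) ⨾ₖ 𝒦 (unitorˡ _)                     ≈⟨ trans ⨾ₖ-𝒦 assoc ⟩
    (η unit ⊗₁ f) ⨾ m _ _ ⨾ T₁ (unitorˡ _)             ≈⟨ pushˡ η⊗f ⟩
    (id ⊗₁ f) ⨾ (m₀ ⊗₁ id) ⨾ m _ _ ⨾ T₁ (unitorˡ _)   ≈⟨ refl⟩⨾⟨ m-unitˡ _ ⟩
    (id ⊗₁ f) ⨾ unitorˡ _                              ≈⟨ unitorˡ-natural f ⟩
    unitorˡ _ ⨾ f                                      ≈⟨ 𝒦-⨾ₖ ⟨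
    𝒦 (unitorˡ _) ⨾ₖ f                                 ∎
    where
    η⊗f : η unit ⊗₁ f ≈ (id ⊗₁ f) ⨾ (m₀ ⊗₁ id)
    η⊗f = trans (⊗-resp-≈ (trans η-monoidal₀ (sym identityˡ)) (sym identityʳ)) ⊗-⨾

  ⊗ₖ-ρ-natural : ∀ (f : A ⇒ T₀ B) → (f ⊗ₖ η unit) ⨾ₖ 𝒦 (unitorʳ B) ≈ 𝒦 (unitorʳ A) ⨾ₖ f
  ⊗ₖ-ρ-natural f = begin
    (f ⊗ₖ η unit) ⨾ₖ 𝒦 (unitorʳ _)                     ≈⟨ trans ⨾ₖ-𝒦 assoc ⟩
    (f ⊗₁ η unit) ⨾ m _ _ ⨾ T₁ (unitorʳ _)             ≈⟨ pushˡ f⊗η ⟩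
    (f ⊗₁ id) ⨾ (id ⊗₁ m₀) ⨾ m _ _ ⨾ T₁ (unitorʳ _)   ≈⟨ refl⟩⨾⟨ m-unitʳ _ ⟩
    (f ⊗₁ id) ⨾ unitorʳ _                              ≈⟨ unitorʳ-natural f ⟩
    unitorʳ _ ⨾ f                                      ≈⟨ 𝒦-⨾ₖ ⟨
    𝒦 (unitorʳ _) ⨾ₖ f                                 ∎
    where
    f⊗η : f ⊗₁ η unit ≈ (f ⊗₁ id) ⨾ (id ⊗₁ m₀)
    f⊗η = trans (⊗-resp-≈ (sym identityʳ) (trans η-monoidal₀ (sym identityˡ))) ⊗-⨾

  ⊗ₖ-σ-natural : ∀ (f : A ⇒ T₀ A') (g : B ⇒ T₀ B') → (f ⊗ₖ g) ⨾ₖ 𝒦 (σ A' B') ≈ 𝒦 (σ A B) ⨾ₖ (g ⊗ₖ f)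
  ⊗ₖ-σ-natural f g = begin
    (f ⊗ₖ g) ⨾ₖ 𝒦 (σ _ _)           ≈⟨ trans ⨾ₖ-𝒦 assoc ⟩
    (f ⊗₁ g) ⨾ m _ _ ⨾ T₁ (σ _ _)   ≈⟨ refl⟩⨾⟨ m-symm _ _ ⟩
    (f ⊗₁ g) ⨾ σ _ _ ⨾ m _ _        ≈⟨ slide (σ-natural f g) ⟩
    σ _ _ ⨾ (g ⊗₁ f) ⨾ m _ _        ≈⟨ 𝒦-⨾ₖ ⟨
    𝒦 (σ _ _) ⨾ₖ (g ⊗ₖ f)           ∎

module Coproducts {o ℓ e} (C : Cat o ℓ e) (Tn Pl : MonoidalData C) (R : RigExtra C Tn Pl)
  (H : IsFcCdRig C Tn Pl R) where
  open Cat C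
  open MonoidalData Tn
  open MonoidalData Pl renaming (_⊗₀_ to _⊕₀_; _⊗₁_ to _⊕₁_; unit to O; α to α⊕; α⁻¹ to α⊕⁻¹;
    unitorˡ to λ⊕; unitorˡ⁻¹ to λ⊕⁻¹; unitorʳ to ρ⊕; unitorʳ⁻¹ to ρ⊕⁻¹; σ to σ⊕)
  open RigExtra R
  open IsFcCdRig H
  open CategoryReasoning C isCategory
  open MonoidalReasoning C isCategory Tn ⊗-symmetricMonoidal
  open MonoidalReasoning C isCategory Pl ⊕-symmetricMonoidal using () renaming
    (⊗-id to ⊕-id; ⊗-⨾ to ⊕-⨾; ⊗-resp-≈ to ⊕-resp-≈; ⊗-inverse to ⊕-inverse;
     α-natural to α⊕-natural; α-isoˡ to α⊕-isoˡ; α-isoʳ to α⊕-isoʳ;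
     unitorˡ-natural to λ⊕-natural; unitorˡ-isoˡ to λ⊕-isoˡ; unitorˡ-isoʳ to λ⊕-isoʳ;
     unitorʳ-natural to ρ⊕-natural; unitorʳ-isoˡ to ρ⊕-isoˡ; unitorʳ-isoʳ to ρ⊕-isoʳ;
     σ-natural to σ⊕-natural; interchange-natural to ⊕-interchange-natural)

  private variable
    A B D A' B' D' X Y : Obj

  ¡-unique : (f : O ⇒ X) → f ≈ ¡ X
  ¡-unique f = begin
    f          ≈⟨ identityˡ ⟨
    id ⨾ f     ≈⟨ ¡-coh-O ⟩⨾⟨refl ⟨
    ¡ O ⨾ f    ≈⟨ ¡-natural f ⟩
    ¡ _        ∎

  O-initial : (f g : O ⇒ X) → f ≈ g
  O-initial f g = trans (¡-unique f) (sym (¡-unique g))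

  retract-of-O-initial : ∀ {s : X ⇒ O} {s' : O ⇒ X} → s ⨾ s' ≈ id → (f g : X ⇒ Y) → f ≈ g
  retract-of-O-initial p f g = trans (sym (cancelˡ p)) (trans (refl⟩⨾⟨ O-initial _ _) (cancelˡ p))

  -- The injections used in the definition of KleisliPlus, without its irrelevant monad parameter.
  ι₁ : ∀ A B → A ⇒ (A ⊕₀ B)
  ι₁ A B = ρ⊕⁻¹ A ⨾ (id ⊕₁ ¡ B)

  ι₂ : ∀ A B → B ⇒ (A ⊕₀ B)
  ι₂ A B = λ⊕⁻¹ B ⨾ (¡ A ⊕₁ id)

  [_,_] : A ⇒ X → B ⇒ X → (A ⊕₀ B) ⇒ X
  [ f , g ] = (f ⊕₁ g) ⨾ ∇ _

  copair-resp : ∀ {f f' : A ⇒ X} {g g' : B ⇒ X} → f ≈ f' → g ≈ g' → [ f , g ] ≈ [ f' , g' ]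
  copair-resp p q = ⊕-resp-≈ p q ⟩⨾⟨refl

  ⊕-⨾-copair : ∀ {a : A ⇒ A'} {b : B ⇒ B'} {f : A' ⇒ X} {g : B' ⇒ X} →
               (a ⊕₁ b) ⨾ [ f , g ] ≈ [ a ⨾ f , b ⨾ g ]
  ⊕-⨾-copair = trans sym-assoc (sym ⊕-⨾ ⟩⨾⟨refl)

  copair-⨾ : ∀ {f : A ⇒ X} {g : B ⇒ X} {h : X ⇒ Y} → [ f , g ] ⨾ h ≈ [ f ⨾ h , g ⨾ h ]
  copair-⨾ {h = h} = trans assoc (trans (refl⟩⨾⟨ sym (∇-natural h)) ⊕-⨾-copair)

  copair-from-Oˡ : ∀ {x : O ⇒ X} {f : A ⇒ X} → [ x , f ] ≈ λ⊕ A ⨾ f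
  copair-from-Oˡ {x = x} {f} = begin
    [ x , f ]                 ≈⟨ copair-resp (trans (¡-unique x) (sym identityˡ)) (sym identityʳ) ⟩
    [ id ⨾ ¡ _ , f ⨾ id ]     ≈⟨ ⊕-⨾-copair ⟨
    (id ⊕₁ f) ⨾ [ ¡ _ , id ]  ≈⟨ refl⟩⨾⟨ ∇-unitˡ _ ⟩
    (id ⊕₁ f) ⨾ λ⊕ _          ≈⟨ λ⊕-natural f ⟩
    λ⊕ _ ⨾ f                  ∎

  copair-from-Oʳ : ∀ {f : A ⇒ X} {x : O ⇒ X} → [ f , x ] ≈ ρ⊕ A ⨾ f
  copair-from-Oʳ {f = f} {x} = begin
    [ f , x ]                 ≈⟨ copair-resp (sym identityʳ) (trans (¡-unique x) (sym identityˡ)) ⟩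
    [ f ⨾ id , id ⨾ ¡ _ ]     ≈⟨ ⊕-⨾-copair ⟨
    (f ⊕₁ id) ⨾ [ id , ¡ _ ]  ≈⟨ refl⟩⨾⟨ ∇-unitʳ _ ⟩
    (f ⊕₁ id) ⨾ ρ⊕ _          ≈⟨ ρ⊕-natural f ⟩
    ρ⊕ _ ⨾ f                  ∎

  ι₁-copair : ∀ {f : A ⇒ X} {g : B ⇒ X} → ι₁ A B ⨾ [ f , g ] ≈ f
  ι₁-copair {f = f} {g} = begin
    (ρ⊕⁻¹ _ ⨾ (id ⊕₁ ¡ _)) ⨾ [ f , g ]  ≈⟨ trans assoc (refl⟩⨾⟨ ⊕-⨾-copair) ⟩
    ρ⊕⁻¹ _ ⨾ [ id ⨾ f , ¡ _ ⨾ g ]        ≈⟨ refl⟩⨾⟨ copair-from-Oʳ ⟩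
    ρ⊕⁻¹ _ ⨾ ρ⊕ _ ⨾ id ⨾ f               ≈⟨ cancelˡ (ρ⊕-isoʳ _) ⟩
    id ⨾ f                               ≈⟨ identityˡ ⟩
    f                                    ∎

  ι₂-copair : ∀ {f : A ⇒ X} {g : B ⇒ X} → ι₂ A B ⨾ [ f , g ] ≈ g
  ι₂-copair {f = f} {g} = begin
    (λ⊕⁻¹ _ ⨾ (¡ _ ⊕₁ id)) ⨾ [ f , g ]  ≈⟨ trans assoc (refl⟩⨾⟨ ⊕-⨾-copair) ⟩
    λ⊕⁻¹ _ ⨾ [ ¡ _ ⨾ f , id ⨾ g ]        ≈⟨ refl⟩⨾⟨ copair-from-Oˡ ⟩
    λ⊕⁻¹ _ ⨾ λ⊕ _ ⨾ id ⨾ g               ≈⟨ cancelˡ (λ⊕-isoʳ _) ⟩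
    id ⨾ g                               ≈⟨ identityˡ ⟩
    g                                    ∎

  σ⊕-OO : σ⊕ O O ≈ id
  σ⊕-OO = retract-of-O-initial (λ⊕-isoˡ O) _ _

  interchange-OO : ∀ A B → interchange C Pl A O O B ≈ id
  interchange-OO A B = begin
    α⊕ _ _ _ ⨾ (id ⊕₁ α⊕⁻¹ _ _ _) ⨾ (id ⊕₁ (σ⊕ O O ⊕₁ id)) ⨾ (id ⊕₁ α⊕ _ _ _) ⨾ α⊕⁻¹ _ _ _
      ≈⟨ refl⟩⨾⟨ refl⟩⨾⟨ trans (σ⊕-OO-free ⟩⨾⟨refl) identityˡ ⟩
    α⊕ _ _ _ ⨾ (id ⊕₁ α⊕⁻¹ _ _ _) ⨾ (id ⊕₁ α⊕ _ _ _) ⨾ α⊕⁻¹ _ _ _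
      ≈⟨ refl⟩⨾⟨ cancelˡ (⊕-inverse identityˡ (α⊕-isoʳ _ _ _)) ⟩
    α⊕ _ _ _ ⨾ α⊕⁻¹ _ _ _
      ≈⟨ α⊕-isoˡ _ _ _ ⟩
    id ∎
    where
    σ⊕-OO-free : id {A} ⊕₁ (σ⊕ O O ⊕₁ id {B}) ≈ id
    σ⊕-OO-free = trans (⊕-resp-≈ refl (trans (⊕-resp-≈ σ⊕-OO refl) ⊕-id)) ⊕-id

  copair-injections : [ ι₁ A B , ι₂ A B ] ≈ id
  copair-injections {A} {B} = begin
    (ι₁ A B ⊕₁ ι₂ A B) ⨾ ∇ (A ⊕₀ B)
      ≈⟨ ⊕-⨾ ⟩⨾⟨ ∇-coh-⊕ A B ⟩
    ((ρ⊕⁻¹ A ⊕₁ λ⊕⁻¹ B) ⨾ ((id ⊕₁ ¡ B) ⊕₁ (¡ A ⊕₁ id))) ⨾ interchange C Pl A B A B ⨾ (∇ A ⊕₁ ∇ B)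
      ≈⟨ trans assoc (refl⟩⨾⟨ slide (⊕-interchange-natural _ _ _ _)) ⟩
    (ρ⊕⁻¹ A ⊕₁ λ⊕⁻¹ B) ⨾ interchange C Pl A O O B ⨾ ((id ⊕₁ ¡ A) ⊕₁ (¡ B ⊕₁ id)) ⨾ (∇ A ⊕₁ ∇ B)
      ≈⟨ refl⟩⨾⟨ trans (interchange-OO A B ⟩⨾⟨refl) identityˡ ⟩
    (ρ⊕⁻¹ A ⊕₁ λ⊕⁻¹ B) ⨾ ((id ⊕₁ ¡ A) ⊕₁ (¡ B ⊕₁ id)) ⨾ (∇ A ⊕₁ ∇ B)
      ≈⟨ refl⟩⨾⟨ trans (sym ⊕-⨾) (⊕-resp-≈ (∇-unitʳ A) (∇-unitˡ B)) ⟩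
    (ρ⊕⁻¹ A ⊕₁ λ⊕⁻¹ B) ⨾ (ρ⊕ A ⊕₁ λ⊕ B)
      ≈⟨ ⊕-inverse (ρ⊕-isoʳ A) (λ⊕-isoʳ B) ⟩
    id ∎

  copair-unique : ∀ {h : (A ⊕₀ B) ⇒ X} {f : A ⇒ X} {g : B ⇒ X} →
                  ι₁ A B ⨾ h ≈ f → ι₂ A B ⨾ h ≈ g → h ≈ [ f , g ]
  copair-unique {h = h} {f} {g} p q = begin
    h                              ≈⟨ identityˡ ⟨
    id ⨾ h                         ≈⟨ copair-injections ⟩⨾⟨refl ⟨
    [ ι₁ _ _ , ι₂ _ _ ] ⨾ h        ≈⟨ copair-⨾ ⟩
    [ ι₁ _ _ ⨾ h , ι₂ _ _ ⨾ h ]    ≈⟨ copair-resp p q ⟩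
    [ f , g ]                      ∎

  ⊕-as-copair : ∀ {f : A ⇒ A'} {g : B ⇒ B'} → f ⊕₁ g ≈ [ f ⨾ ι₁ A' B' , g ⨾ ι₂ A' B' ]
  ⊕-as-copair = trans (sym identityʳ) (trans (refl⟩⨾⟨ sym copair-injections) ⊕-⨾-copair)

  ι₁-natural : ∀ {f : A ⇒ A'} {g : B ⇒ B'} → ι₁ A B ⨾ (f ⊕₁ g) ≈ f ⨾ ι₁ A' B'
  ι₁-natural = trans (refl⟩⨾⟨ ⊕-as-copair) ι₁-copair

  ι₂-natural : ∀ {f : A ⇒ A'} {g : B ⇒ B'} → ι₂ A B ⨾ (f ⊕₁ g) ≈ g ⨾ ι₂ A' B'
  ι₂-natural = trans (refl⟩⨾⟨ ⊕-as-copair) ι₂-copair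

  ι₁-∇ : ι₁ A A ⨾ ∇ A ≈ id
  ι₁-∇ = trans assoc (trans (refl⟩⨾⟨ ∇-unitʳ _) (ρ⊕-isoʳ _))

  ι₂-∇ : ι₂ A A ⨾ ∇ A ≈ id
  ι₂-∇ = trans assoc (trans (refl⟩⨾⟨ ∇-unitˡ _) (λ⊕-isoʳ _))

  ι₁-ρ⊕ : ι₁ A O ⨾ ρ⊕ A ≈ id
  ι₁-ρ⊕ = trans (refl⟩⨾⟨ sym (trans (copair-from-Oʳ {x = ¡ _}) identityʳ)) ι₁-copair

  ι₂-λ⊕ : ι₂ O A ⨾ λ⊕ A ≈ id
  ι₂-λ⊕ = trans (refl⟩⨾⟨ sym (trans (copair-from-Oˡ {x = ¡ _}) identityʳ)) ι₂-copair

  σ⊕-copair : ∀ {f : A ⇒ X} {g : B ⇒ X} → σ⊕ A B ⨾ [ g , f ] ≈ [ f , g ]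
  σ⊕-copair = trans (slide (sym (σ⊕-natural _ _))) (refl⟩⨾⟨ ∇-comm _)

  σ⊕-as-copair : σ⊕ A B ≈ [ ι₂ B A , ι₁ B A ]
  σ⊕-as-copair = trans (sym identityʳ) (trans (refl⟩⨾⟨ sym copair-injections) σ⊕-copair)

  ι₁-σ⊕ : ι₁ A B ⨾ σ⊕ A B ≈ ι₂ B A
  ι₁-σ⊕ = trans (refl⟩⨾⟨ σ⊕-as-copair) ι₁-copair

  ι₂-σ⊕ : ι₂ A B ⨾ σ⊕ A B ≈ ι₁ B A
  ι₂-σ⊕ = trans (refl⟩⨾⟨ σ⊕-as-copair) ι₂-copair

  α⊕-copair : ∀ {f : A ⇒ X} {g : B ⇒ X} {h : D ⇒ X} → α⊕ A B D ⨾ [ f , [ g , h ] ] ≈ [ [ f , g ] , h ]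
  α⊕-copair {f = f} {g} {h} = begin
    α⊕ _ _ _ ⨾ [ f , [ g , h ] ]               ≈⟨ refl⟩⨾⟨ copair-resp identityʳ refl ⟨
    α⊕ _ _ _ ⨾ [ f ⨾ id , (g ⊕₁ h) ⨾ ∇ _ ]     ≈⟨ refl⟩⨾⟨ ⊕-⨾-copair ⟨
    α⊕ _ _ _ ⨾ (f ⊕₁ (g ⊕₁ h)) ⨾ [ id , ∇ _ ]  ≈⟨ slide (α⊕-natural f g h) ⟨
    ((f ⊕₁ g) ⊕₁ h) ⨾ α⊕ _ _ _ ⨾ [ id , ∇ _ ]  ≈⟨ refl⟩⨾⟨ ∇-assoc _ ⟨
    ((f ⊕₁ g) ⊕₁ h) ⨾ [ ∇ _ , id ]             ≈⟨ ⊕-⨾-copair ⟩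
    [ (f ⊕₁ g) ⨾ ∇ _ , h ⨾ id ]                ≈⟨ copair-resp refl identityʳ ⟩
    [ [ f , g ] , h ]                          ∎

  α⊕-as-copair : α⊕ A B D ≈ [ [ ι₁ A (B ⊕₀ D) , ι₁ B D ⨾ ι₂ A (B ⊕₀ D) ] , ι₂ B D ⨾ ι₂ A (B ⊕₀ D) ]
  α⊕-as-copair {A} {B} {D} = begin
    α⊕ _ _ _                                                        ≈⟨ identityʳ ⟨
    α⊕ _ _ _ ⨾ id                                                   ≈⟨ refl⟩⨾⟨ id-as-copair ⟩
    α⊕ _ _ _ ⨾ [ ι₁ _ _ , [ ι₁ _ _ ⨾ ι₂ _ _ , ι₂ _ _ ⨾ ι₂ _ _ ] ]  ≈⟨ α⊕-copair ⟩
    [ [ ι₁ _ _ , ι₁ _ _ ⨾ ι₂ _ _ ] , ι₂ _ _ ⨾ ι₂ _ _ ]              ∎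
    where
    id-as-copair : id ≈ [ ι₁ A (B ⊕₀ D) , [ ι₁ B D ⨾ ι₂ A (B ⊕₀ D) , ι₂ B D ⨾ ι₂ A (B ⊕₀ D) ] ]
    id-as-copair = trans (sym copair-injections) (copair-resp refl (copair-unique refl refl))

  ι₁-ι₁-α⊕ : ι₁ A B ⨾ ι₁ (A ⊕₀ B) D ⨾ α⊕ A B D ≈ ι₁ A (B ⊕₀ D)
  ι₁-ι₁-α⊕ = trans (refl⟩⨾⟨ trans (refl⟩⨾⟨ α⊕-as-copair) ι₁-copair) ι₁-copair

  ι₂-ι₁-α⊕ : ι₂ A B ⨾ ι₁ (A ⊕₀ B) D ⨾ α⊕ A B D ≈ ι₁ B D ⨾ ι₂ A (B ⊕₀ D)
  ι₂-ι₁-α⊕ = trans (refl⟩⨾⟨ trans (refl⟩⨾⟨ α⊕-as-copair) ι₁-copair) ι₂-copair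

  ι₂-α⊕ : ι₂ (A ⊕₀ B) D ⨾ α⊕ A B D ≈ ι₂ B D ⨾ ι₂ A (B ⊕₀ D)
  ι₂-α⊕ = trans (refl⟩⨾⟨ α⊕-as-copair) ι₂-copair

  δl-ι₁ : (id {A} ⊗₁ ι₁ B D) ⨾ δl A B D ≈ ι₁ (A ⊗₀ B) (A ⊗₀ D)
  δl-ι₁ {A} {B} {D} = begin
    (id ⊗₁ (ρ⊕⁻¹ B ⨾ (id ⊕₁ ¡ D))) ⨾ δl A B D                  ≈⟨ pushˡ ⊗-⨾-id⊗ ⟩
    (id ⊗₁ ρ⊕⁻¹ B) ⨾ (id ⊗₁ (id ⊕₁ ¡ D)) ⨾ δl A B D            ≈⟨ refl⟩⨾⟨ δl-natural _ _ _ ⟩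
    (id ⊗₁ ρ⊕⁻¹ B) ⨾ δl A B O ⨾ ((id ⊗₁ id) ⊕₁ (id ⊗₁ ¡ D))   ≈⟨ pullˡ unit-case ⟩
    (ρ⊕⁻¹ _ ⨾ (id ⊕₁ annʳ⁻¹ A)) ⨾ ((id ⊗₁ id) ⊕₁ (id ⊗₁ ¡ D)) ≈⟨ trans assoc (refl⟩⨾⟨ sym ⊕-⨾) ⟩
    ρ⊕⁻¹ _ ⨾ ((id ⨾ (id ⊗₁ id)) ⊕₁ (annʳ⁻¹ A ⨾ (id ⊗₁ ¡ D)))   ≈⟨ refl⟩⨾⟨ ⊕-resp-≈ (trans identityˡ ⊗-id) (¡-unique _) ⟩
    ρ⊕⁻¹ _ ⨾ (id ⊕₁ ¡ _)                                       ∎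
    where
    unit-case : (id ⊗₁ ρ⊕⁻¹ B) ⨾ δl A B O ≈ ρ⊕⁻¹ (A ⊗₀ B) ⨾ (id ⊕₁ annʳ⁻¹ A)
    unit-case = trans (refl⟩⨾⟨ move-isoʳ (laplaza-XXI A B) (⨾-inverse (⊕-inverse identityˡ (annʳ-isoˡ A)) (ρ⊕-isoˡ _)))
                      (cancelˡ (⊗-inverse identityˡ (ρ⊕-isoʳ B)))

  δl-ι₂ : (id {A} ⊗₁ ι₂ B D) ⨾ δl A B D ≈ ι₂ (A ⊗₀ B) (A ⊗₀ D)
  δl-ι₂ {A} {B} {D} = begin
    (id ⊗₁ ι₂ B D) ⨾ δl A B D                    ≈⟨ pushˡ (trans (⊗-resp-≈ refl (sym ι₁-σ⊕)) ⊗-⨾-id⊗) ⟩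
    (id ⊗₁ ι₁ D B) ⨾ (id ⊗₁ σ⊕ D B) ⨾ δl A B D   ≈⟨ refl⟩⨾⟨ laplaza-I A D B ⟨
    (id ⊗₁ ι₁ D B) ⨾ δl A D B ⨾ σ⊕ _ _           ≈⟨ pullˡ δl-ι₁ ⟩
    ι₁ _ _ ⨾ σ⊕ _ _                              ≈⟨ ι₁-σ⊕ ⟩
    ι₂ _ _                                       ∎

  δr-ι₁ : (ι₁ A B ⊗₁ id {D}) ⨾ δr A B D ≈ ι₁ (A ⊗₀ D) (B ⊗₀ D)
  δr-ι₁ {A} {B} {D} = begin
    (ι₁ A B ⊗₁ id) ⨾ δr A B D                                    ≈⟨ refl⟩⨾⟨ laplaza-III A B D ⟨
    (ι₁ A B ⊗₁ id) ⨾ σ _ D ⨾ δl D A B ⨾ (σ D A ⊕₁ σ D B)        ≈⟨ slide (σ-natural _ _) ⟩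
    σ A D ⨾ (id ⊗₁ ι₁ A B) ⨾ δl D A B ⨾ (σ D A ⊕₁ σ D B)        ≈⟨ refl⟩⨾⟨ pullˡ δl-ι₁ ⟩
    σ A D ⨾ ι₁ _ _ ⨾ (σ D A ⊕₁ σ D B)                           ≈⟨ refl⟩⨾⟨ ι₁-natural ⟩
    σ A D ⨾ σ D A ⨾ ι₁ _ _                                      ≈⟨ cancelˡ (σ-involutive A D) ⟩
    ι₁ _ _                                                      ∎

  δr-ι₂ : (ι₂ A B ⊗₁ id {D}) ⨾ δr A B D ≈ ι₂ (A ⊗₀ D) (B ⊗₀ D)
  δr-ι₂ {A} {B} {D} = begin
    (ι₂ A B ⊗₁ id) ⨾ δr A B D                                    ≈⟨ refl⟩⨾⟨ laplaza-III A B D ⟨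
    (ι₂ A B ⊗₁ id) ⨾ σ _ D ⨾ δl D A B ⨾ (σ D A ⊕₁ σ D B)        ≈⟨ slide (σ-natural _ _) ⟩
    σ B D ⨾ (id ⊗₁ ι₂ A B) ⨾ δl D A B ⨾ (σ D A ⊕₁ σ D B)        ≈⟨ refl⟩⨾⟨ pullˡ δl-ι₂ ⟩
    σ B D ⨾ ι₂ _ _ ⨾ (σ D A ⊕₁ σ D B)                           ≈⟨ refl⟩⨾⟨ ι₂-natural ⟩
    σ B D ⨾ σ D B ⨾ ι₂ _ _                                      ≈⟨ cancelˡ (σ-involutive B D) ⟩
    ι₂ _ _                                                      ∎

  ⊗-copair : ∀ {f : A ⇒ A'} {g : B ⇒ X} {h : D ⇒ X} → f ⊗₁ [ g , h ] ≈ δl A B D ⨾ [ f ⊗₁ g , f ⊗₁ h ]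
  ⊗-copair {A} {A'} {B} {X} {D} {f} {g} {h} = begin
    f ⊗₁ [ g , h ]                           ≈⟨ cancelˡ (δl-isoˡ _ _ _) ⟨
    δl _ _ _ ⨾ δl⁻¹ _ _ _ ⨾ (f ⊗₁ [ g , h ])  ≈⟨ refl⟩⨾⟨ copair-unique (on δl-ι₁ ι₁-copair) (on δl-ι₂ ι₂-copair) ⟩
    δl _ _ _ ⨾ [ f ⊗₁ g , f ⊗₁ h ]           ∎
    where
    on : ∀ {E} {i : E ⇒ (B ⊕₀ D)} {j : (A ⊗₀ E) ⇒ ((A ⊗₀ B) ⊕₀ (A ⊗₀ D))} {x : E ⇒ X} →
         (id ⊗₁ i) ⨾ δl A B D ≈ j → i ⨾ [ g , h ] ≈ x → j ⨾ δl⁻¹ A B D ⨾ (f ⊗₁ [ g , h ]) ≈ f ⊗₁ x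
    on p q = trans (pullˡ (sym (move-isoʳ p (δl-isoˡ _ _ _)))) (trans (sym ⊗-⨾) (⊗-resp-≈ identityˡ q))

  copair-⊗ : ∀ {f : D ⇒ D'} {g : A ⇒ X} {h : B ⇒ X} → [ g , h ] ⊗₁ f ≈ δr A B D ⨾ [ g ⊗₁ f , h ⊗₁ f ]
  copair-⊗ {D} {D'} {A} {X} {B} {f} {g} {h} = begin
    [ g , h ] ⊗₁ f                           ≈⟨ cancelˡ (δr-isoˡ _ _ _) ⟨
    δr _ _ _ ⨾ δr⁻¹ _ _ _ ⨾ ([ g , h ] ⊗₁ f)  ≈⟨ refl⟩⨾⟨ copair-unique (on δr-ι₁ ι₁-copair) (on δr-ι₂ ι₂-copair) ⟩
    δr _ _ _ ⨾ [ g ⊗₁ f , h ⊗₁ f ]           ∎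
    where
    on : ∀ {E} {i : E ⇒ (A ⊕₀ B)} {j : (E ⊗₀ D) ⇒ ((A ⊗₀ D) ⊕₀ (B ⊗₀ D))} {x : E ⇒ X} →
         (i ⊗₁ id) ⨾ δr A B D ≈ j → i ⨾ [ g , h ] ≈ x → j ⨾ δr⁻¹ A B D ⨾ ([ g , h ] ⊗₁ f) ≈ x ⊗₁ f
    on p q = trans (pullˡ (sym (move-isoʳ p (δr-isoˡ _ _ _)))) (trans (sym ⊗-⨾) (⊗-resp-≈ q identityˡ))

module KleisliCoproducts {o ℓ e} (C : Cat o ℓ e) (Tn Pl : MonoidalData C) (R : RigExtra C Tn Pl)
  (H : IsFcCdRig C Tn Pl R) (M : SymMonMonad C Tn) where
  open Cat C
  open MonoidalData Tn
  open MonoidalData Pl renaming (_⊗₀_ to _⊕₀_; _⊗₁_ to _⊕₁_; unit to O; α to α⊕; α⁻¹ to α⊕⁻¹;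
    unitorˡ to λ⊕; unitorˡ⁻¹ to λ⊕⁻¹; unitorʳ to ρ⊕; unitorʳ⁻¹ to ρ⊕⁻¹; σ to σ⊕)
  open RigExtra R
  open SymMonMonad M
  open IsFcCdRig H
  open CategoryReasoning C isCategory
  open MonoidalReasoning C isCategory Pl ⊕-symmetricMonoidal using () renaming (⊗-id to ⊕-id)
  open Coproducts C Tn Pl R H
  open KleisliCategory C isCategory Tn ⊗-symmetricMonoidal M
  open MonoidalData (KleisliPlus C Tn M Pl R) public using () renaming (_⊗₁_ to infixr 8 _⊕ₖ_)

  private variable
    A B D A' B' D' X : Obj

  ⊕ₖ-resp : ∀ {f f' : A ⇒ T₀ B} {g g' : A' ⇒ T₀ B'} → f ≈ f' → g ≈ g' → f ⊕ₖ g ≈ f' ⊕ₖ g'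
  ⊕ₖ-resp p q = copair-resp (p ⟩⨾⟨refl) (q ⟩⨾⟨refl)

  ⊕ₖ-T₁ : ∀ {f : A ⇒ T₀ A'} {g : B ⇒ T₀ B'} {h : (A' ⊕₀ B') ⇒ X} →
          (f ⊕ₖ g) ⨾ T₁ h ≈ [ f ⨾ T₁ (ι₁ A' B' ⨾ h) , g ⨾ T₁ (ι₂ A' B' ⨾ h) ]
  ⊕ₖ-T₁ = trans copair-⨾ (copair-resp T₁-fuse T₁-fuse)

  𝒦-⊕ : ∀ {f : A ⇒ A'} {g : B ⇒ B'} → 𝒦 f ⊕ₖ 𝒦 g ≈ 𝒦 (f ⊕₁ g)
  𝒦-⊕ = trans (copair-resp 𝒦-T₁ 𝒦-T₁) (trans (sym copair-⨾) (sym ⊕-as-copair ⟩⨾⟨refl))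

  ⊕ₖ-identity : η A ⊕ₖ η B ≈ η (A ⊕₀ B)
  ⊕ₖ-identity = trans (⊕ₖ-resp 𝒦-identity 𝒦-identity) (trans 𝒦-⊕ (trans (⊕-id ⟩⨾⟨refl) identityˡ))

  ⊕ₖ-homomorphism : ∀ (f : A ⇒ T₀ B) (g : B ⇒ T₀ D) (f' : A' ⇒ T₀ B') (g' : B' ⇒ T₀ D') →
                    (f ⨾ₖ g) ⊕ₖ (f' ⨾ₖ g') ≈ (f ⊕ₖ f') ⨾ₖ (g ⊕ₖ g')
  ⊕ₖ-homomorphism f g f' g' = sym (begin
    (f ⊕ₖ f') ⨾ₖ (g ⊕ₖ g')
      ≈⟨ copair-⨾ ⟩
    [ (f ⨾ T₁ (ι₁ _ _)) ⨾ₖ (g ⊕ₖ g') , (f' ⨾ T₁ (ι₂ _ _)) ⨾ₖ (g ⊕ₖ g') ]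
      ≈⟨ copair-resp T₁-⨾ₖ T₁-⨾ₖ ⟩
    [ f ⨾ₖ (ι₁ _ _ ⨾ (g ⊕ₖ g')) , f' ⨾ₖ (ι₂ _ _ ⨾ (g ⊕ₖ g')) ]
      ≈⟨ copair-resp (⨾ₖ-resp refl ι₁-copair) (⨾ₖ-resp refl ι₂-copair) ⟩
    [ f ⨾ₖ (g ⨾ T₁ (ι₁ _ _)) , f' ⨾ₖ (g' ⨾ T₁ (ι₂ _ _)) ]
      ≈⟨ copair-resp ⨾ₖ-T₁ ⨾ₖ-T₁ ⟩
    (f ⨾ₖ g) ⊕ₖ (f' ⨾ₖ g') ∎)

  ⊕ₖ-α-natural : ∀ (f : A ⇒ T₀ A') (g : B ⇒ T₀ B') (h : D ⇒ T₀ D') →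
                 ((f ⊕ₖ g) ⊕ₖ h) ⨾ₖ 𝒦 (α⊕ A' B' D') ≈ 𝒦 (α⊕ A B D) ⨾ₖ (f ⊕ₖ (g ⊕ₖ h))
  ⊕ₖ-α-natural f g h = begin
    ((f ⊕ₖ g) ⊕ₖ h) ⨾ₖ 𝒦 (α⊕ _ _ _)
      ≈⟨ trans ⨾ₖ-𝒦 (trans ⊕ₖ-T₁ (copair-resp ⊕ₖ-T₁ refl)) ⟩
    [ [ f ⨾ T₁ (ι₁ _ _ ⨾ ι₁ _ _ ⨾ α⊕ _ _ _) , g ⨾ T₁ (ι₂ _ _ ⨾ ι₁ _ _ ⨾ α⊕ _ _ _) ] , h ⨾ T₁ (ι₂ _ _ ⨾ α⊕ _ _ _) ]
      ≈⟨ copair-resp (copair-resp (refl⟩⨾⟨ T-resp-≈ ι₁-ι₁-α⊕) (refl⟩⨾⟨ T-resp-≈ ι₂-ι₁-α⊕))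
                     (refl⟩⨾⟨ T-resp-≈ ι₂-α⊕) ⟩
    [ [ f ⨾ T₁ (ι₁ _ _) , g ⨾ T₁ (ι₁ _ _ ⨾ ι₂ _ _) ] , h ⨾ T₁ (ι₂ _ _ ⨾ ι₂ _ _) ]
      ≈⟨ α⊕-copair ⟨
    α⊕ _ _ _ ⨾ [ f ⨾ T₁ (ι₁ _ _) , [ g ⨾ T₁ (ι₁ _ _ ⨾ ι₂ _ _) , h ⨾ T₁ (ι₂ _ _ ⨾ ι₂ _ _) ] ]
      ≈⟨ refl⟩⨾⟨ copair-resp refl ⊕ₖ-T₁ ⟨
    α⊕ _ _ _ ⨾ (f ⊕ₖ (g ⊕ₖ h))
      ≈⟨ 𝒦-⨾ₖ ⟨
    𝒦 (α⊕ _ _ _) ⨾ₖ (f ⊕ₖ (g ⊕ₖ h)) ∎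

  ⊕ₖ-λ-natural : ∀ (f : A ⇒ T₀ B) → (η O ⊕ₖ f) ⨾ₖ 𝒦 (λ⊕ B) ≈ 𝒦 (λ⊕ A) ⨾ₖ f
  ⊕ₖ-λ-natural f = begin
    (η O ⊕ₖ f) ⨾ₖ 𝒦 (λ⊕ _)                                 ≈⟨ trans ⨾ₖ-𝒦 ⊕ₖ-T₁ ⟩
    [ η O ⨾ T₁ (ι₁ _ _ ⨾ λ⊕ _) , f ⨾ T₁ (ι₂ _ _ ⨾ λ⊕ _) ]  ≈⟨ copair-resp refl (T₁-id ι₂-λ⊕) ⟩
    [ η O ⨾ T₁ (ι₁ _ _ ⨾ λ⊕ _) , f ]                       ≈⟨ copair-from-Oˡ ⟩
    λ⊕ _ ⨾ f                                               ≈⟨ 𝒦-⨾ₖ ⟨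
    𝒦 (λ⊕ _) ⨾ₖ f                                          ∎

  ⊕ₖ-ρ-natural : ∀ (f : A ⇒ T₀ B) → (f ⊕ₖ η O) ⨾ₖ 𝒦 (ρ⊕ B) ≈ 𝒦 (ρ⊕ A) ⨾ₖ f
  ⊕ₖ-ρ-natural f = begin
    (f ⊕ₖ η O) ⨾ₖ 𝒦 (ρ⊕ _)                                 ≈⟨ trans ⨾ₖ-𝒦 ⊕ₖ-T₁ ⟩
    [ f ⨾ T₁ (ι₁ _ _ ⨾ ρ⊕ _) , η O ⨾ T₁ (ι₂ _ _ ⨾ ρ⊕ _) ]  ≈⟨ copair-resp (T₁-id ι₁-ρ⊕) refl ⟩
    [ f , η O ⨾ T₁ (ι₂ _ _ ⨾ ρ⊕ _) ]                       ≈⟨ copair-from-Oʳ ⟩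
    ρ⊕ _ ⨾ f                                               ≈⟨ 𝒦-⨾ₖ ⟨
    𝒦 (ρ⊕ _) ⨾ₖ f                                          ∎

  ⊕ₖ-σ-natural : ∀ (f : A ⇒ T₀ A') (g : B ⇒ T₀ B') → (f ⊕ₖ g) ⨾ₖ 𝒦 (σ⊕ A' B') ≈ 𝒦 (σ⊕ A B) ⨾ₖ (g ⊕ₖ f)
  ⊕ₖ-σ-natural f g = begin
    (f ⊕ₖ g) ⨾ₖ 𝒦 (σ⊕ _ _)                                     ≈⟨ trans ⨾ₖ-𝒦 ⊕ₖ-T₁ ⟩
    [ f ⨾ T₁ (ι₁ _ _ ⨾ σ⊕ _ _) , g ⨾ T₁ (ι₂ _ _ ⨾ σ⊕ _ _) ]    ≈⟨ copair-resp (refl⟩⨾⟨ T-resp-≈ ι₁-σ⊕)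
                                                                              (refl⟩⨾⟨ T-resp-≈ ι₂-σ⊕) ⟩
    [ f ⨾ T₁ (ι₂ _ _) , g ⨾ T₁ (ι₁ _ _) ]                      ≈⟨ σ⊕-copair ⟨
    σ⊕ _ _ ⨾ (g ⊕ₖ f)                                          ≈⟨ 𝒦-⨾ₖ ⟨
    𝒦 (σ⊕ _ _) ⨾ₖ (g ⊕ₖ f)                                     ∎

  ∇ₖ-natural : ∀ (f : A ⇒ T₀ B) → (f ⊕ₖ f) ⨾ₖ 𝒦 (∇ B) ≈ 𝒦 (∇ A) ⨾ₖ f
  ∇ₖ-natural f = begin
    (f ⊕ₖ f) ⨾ₖ 𝒦 (∇ _)                                ≈⟨ trans ⨾ₖ-𝒦 ⊕ₖ-T₁ ⟩
    [ f ⨾ T₁ (ι₁ _ _ ⨾ ∇ _) , f ⨾ T₁ (ι₂ _ _ ⨾ ∇ _) ]  ≈⟨ copair-resp (T₁-id ι₁-∇) (T₁-id ι₂-∇) ⟩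
    [ f , f ]                                          ≈⟨ ∇-natural f ⟩
    ∇ _ ⨾ f                                            ≈⟨ 𝒦-⨾ₖ ⟨
    𝒦 (∇ _) ⨾ₖ f                                       ∎

  δlₖ-natural : ∀ (f : A ⇒ T₀ A') (g : B ⇒ T₀ B') (h : D ⇒ T₀ D') →
                (f ⊗ₖ (g ⊕ₖ h)) ⨾ₖ 𝒦 (δl A' B' D') ≈ 𝒦 (δl A B D) ⨾ₖ ((f ⊗ₖ g) ⊕ₖ (f ⊗ₖ h))
  δlₖ-natural {A} {A'} {B} {B'} {D} {D'} f g h = begin
    (f ⊗ₖ (g ⊕ₖ h)) ⨾ₖ 𝒦 (δl _ _ _)
      ≈⟨ trans ⨾ₖ-𝒦 assoc ⟩
    (f ⊗₁ [ g ⨾ T₁ (ι₁ _ _) , h ⨾ T₁ (ι₂ _ _) ]) ⨾ m _ _ ⨾ T₁ (δl _ _ _)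
      ≈⟨ trans (pushˡ ⊗-copair) (refl⟩⨾⟨ copair-⨾) ⟩
    δl _ _ _ ⨾ [ (f ⊗₁ (g ⨾ T₁ (ι₁ _ _))) ⨾ m _ _ ⨾ T₁ (δl _ _ _) , (f ⊗₁ (h ⨾ T₁ (ι₂ _ _))) ⨾ m _ _ ⨾ T₁ (δl _ _ _) ]
      ≈⟨ refl⟩⨾⟨ copair-resp (through δl-ι₁) (through δl-ι₂) ⟩
    δl _ _ _ ⨾ ((f ⊗ₖ g) ⊕ₖ (f ⊗ₖ h))
      ≈⟨ 𝒦-⨾ₖ ⟨
    𝒦 (δl _ _ _) ⨾ₖ ((f ⊗ₖ g) ⊕ₖ (f ⊗ₖ h)) ∎
    where
    through : ∀ {E Y} {x : E ⇒ T₀ Y} {j : Y ⇒ (B' ⊕₀ D')} {k : (A' ⊗₀ Y) ⇒ ((A' ⊗₀ B') ⊕₀ (A' ⊗₀ D'))} →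
              (id ⊗₁ j) ⨾ δl A' B' D' ≈ k →
              (f ⊗₁ (x ⨾ T₁ j)) ⨾ m A' (B' ⊕₀ D') ⨾ T₁ (δl A' B' D') ≈ (f ⊗ₖ x) ⨾ T₁ k
    through p = trans sym-assoc (trans (trans (⊗ₖ-resp (sym (T₁-id refl)) refl) ⊗ₖ-T₁ ⟩⨾⟨refl)
                                       (trans T₁-fuse (refl⟩⨾⟨ T-resp-≈ p)))

  δrₖ-natural : ∀ (f : A ⇒ T₀ A') (g : B ⇒ T₀ B') (h : D ⇒ T₀ D') →
                ((f ⊕ₖ g) ⊗ₖ h) ⨾ₖ 𝒦 (δr A' B' D') ≈ 𝒦 (δr A B D) ⨾ₖ ((f ⊗ₖ h) ⊕ₖ (g ⊗ₖ h))
  δrₖ-natural {A} {A'} {B} {B'} {D} {D'} f g h = begin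
    ((f ⊕ₖ g) ⊗ₖ h) ⨾ₖ 𝒦 (δr _ _ _)
      ≈⟨ trans ⨾ₖ-𝒦 assoc ⟩
    ([ f ⨾ T₁ (ι₁ _ _) , g ⨾ T₁ (ι₂ _ _) ] ⊗₁ h) ⨾ m _ _ ⨾ T₁ (δr _ _ _)
      ≈⟨ trans (pushˡ copair-⊗) (refl⟩⨾⟨ copair-⨾) ⟩
    δr _ _ _ ⨾ [ ((f ⨾ T₁ (ι₁ _ _)) ⊗₁ h) ⨾ m _ _ ⨾ T₁ (δr _ _ _) , ((g ⨾ T₁ (ι₂ _ _)) ⊗₁ h) ⨾ m _ _ ⨾ T₁ (δr _ _ _) ]
      ≈⟨ refl⟩⨾⟨ copair-resp (through δr-ι₁) (through δr-ι₂) ⟩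
    δr _ _ _ ⨾ ((f ⊗ₖ h) ⊕ₖ (g ⊗ₖ h))
      ≈⟨ 𝒦-⨾ₖ ⟨
    𝒦 (δr _ _ _) ⨾ₖ ((f ⊗ₖ h) ⊕ₖ (g ⊗ₖ h)) ∎
    where
    through : ∀ {E Y} {x : E ⇒ T₀ Y} {j : Y ⇒ (A' ⊕₀ B')} {k : (Y ⊗₀ D') ⇒ ((A' ⊗₀ D') ⊕₀ (B' ⊗₀ D'))} →
              (j ⊗₁ id) ⨾ δr A' B' D' ≈ k →
              ((x ⨾ T₁ j) ⊗₁ h) ⨾ m (A' ⊕₀ B') D' ⨾ T₁ (δr A' B' D') ≈ (x ⊗ₖ h) ⨾ T₁ k
    through p = trans sym-assoc (trans (trans (⊗ₖ-resp refl (sym (T₁-id refl))) ⊗ₖ-T₁ ⟩⨾⟨refl)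
                                       (trans T₁-fuse (refl⟩⨾⟨ T-resp-≈ p)))

module StructuralTransfer {o ℓ e} (C : Cat o ℓ e) (Tn Pl : MonoidalData C) (R : RigExtra C Tn Pl)
  (H : IsFcCdRig C Tn Pl R) (M : SymMonMonad C Tn) where
  open Cat C
  open MonoidalData Tn
  open MonoidalData Pl renaming (_⊗₀_ to _⊕₀_; _⊗₁_ to _⊕₁_; α to α⊕; α⁻¹ to α⊕⁻¹; σ to σ⊕)
  open SymMonMonad M
  open IsFcCdRig H using (isCategory; ⊗-symmetricMonoidal)
  open CategoryReasoning C isCategory
  open KleisliCategory C isCategory Tn ⊗-symmetricMonoidal M
  open KleisliCoproducts C Tn Pl R H M

  private variable
    A B A' B' : Obj

  infixr 5 _⨾ₑ_
  infixr 8 _⊗ₑ_ _⊕ₑ_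

  data Expr : Obj → Obj → Set (o ⊔ ℓ) where
    ⌜_⌝  : A ⇒ B → Expr A B
    idₑ  : Expr A A
    _⨾ₑ_ : ∀ {D} → Expr A B → Expr B D → Expr A D
    _⊗ₑ_ : Expr A B → Expr A' B' → Expr (A ⊗₀ A') (B ⊗₀ B')
    _⊕ₑ_ : Expr A B → Expr A' B' → Expr (A ⊕₀ A') (B ⊕₀ B')

  ⟦_⟧ : Expr A B → A ⇒ B
  ⟦ ⌜ f ⌝ ⟧  = f
  ⟦ idₑ ⟧    = id
  ⟦ t ⨾ₑ u ⟧ = ⟦ t ⟧ ⨾ ⟦ u ⟧
  ⟦ t ⊗ₑ u ⟧ = ⟦ t ⟧ ⊗₁ ⟦ u ⟧
  ⟦ t ⊕ₑ u ⟧ = ⟦ t ⟧ ⊕₁ ⟦ u ⟧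

  ⟦_⟧ₖ : Expr A B → A ⇒ T₀ B
  ⟦ ⌜ f ⌝ ⟧ₖ  = 𝒦 f
  ⟦ idₑ ⟧ₖ    = η _
  ⟦ t ⨾ₑ u ⟧ₖ = ⟦ t ⟧ₖ ⨾ₖ ⟦ u ⟧ₖ
  ⟦ t ⊗ₑ u ⟧ₖ = ⟦ t ⟧ₖ ⊗ₖ ⟦ u ⟧ₖ
  ⟦ t ⊕ₑ u ⟧ₖ = ⟦ t ⟧ₖ ⊕ₖ ⟦ u ⟧ₖ

  𝒦-⟦⟧ : (t : Expr A B) → ⟦ t ⟧ₖ ≈ 𝒦 ⟦ t ⟧
  𝒦-⟦⟧ ⌜ f ⌝    = refl
  𝒦-⟦⟧ idₑ      = 𝒦-identity
  𝒦-⟦⟧ (t ⨾ₑ u) = trans (⨾ₖ-resp (𝒦-⟦⟧ t) (𝒦-⟦⟧ u)) 𝒦-homomorphism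
  𝒦-⟦⟧ (t ⊗ₑ u) = trans (⊗ₖ-resp (𝒦-⟦⟧ t) (𝒦-⟦⟧ u)) 𝒦-⊗
  𝒦-⟦⟧ (t ⊕ₑ u) = trans (⊕ₖ-resp (𝒦-⟦⟧ t) (𝒦-⟦⟧ u)) 𝒦-⊕

  transfer : (t u : Expr A B) → ⟦ t ⟧ ≈ ⟦ u ⟧ → ⟦ t ⟧ₖ ≈ ⟦ u ⟧ₖ
  transfer t u p = trans (𝒦-⟦⟧ t) (trans (p ⟩⨾⟨refl) (sym (𝒦-⟦⟧ u)))

  transfer-inverse : ∀ {f : A ⇒ B} {g : B ⇒ A} → f ⨾ g ≈ id → 𝒦 f ⨾ₖ 𝒦 g ≈ η A
  transfer-inverse {f = f} {g} = transfer (⌜ f ⌝ ⨾ₑ ⌜ g ⌝) idₑ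

  ⊗-interchangeₑ : ∀ W X Y Z → Expr ((W ⊗₀ X) ⊗₀ (Y ⊗₀ Z)) ((W ⊗₀ Y) ⊗₀ (X ⊗₀ Z))
  ⊗-interchangeₑ W X Y Z = ⌜ α W X (Y ⊗₀ Z) ⌝ ⨾ₑ (idₑ ⊗ₑ ⌜ α⁻¹ X Y Z ⌝) ⨾ₑ (idₑ ⊗ₑ (⌜ σ X Y ⌝ ⊗ₑ idₑ))
                           ⨾ₑ (idₑ ⊗ₑ ⌜ α Y X Z ⌝) ⨾ₑ ⌜ α⁻¹ W Y (X ⊗₀ Z) ⌝

  ⊕-interchangeₑ : ∀ W X Y Z → Expr ((W ⊕₀ X) ⊕₀ (Y ⊕₀ Z)) ((W ⊕₀ Y) ⊕₀ (X ⊕₀ Z))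
  ⊕-interchangeₑ W X Y Z = ⌜ α⊕ W X (Y ⊕₀ Z) ⌝ ⨾ₑ (idₑ ⊕ₑ ⌜ α⊕⁻¹ X Y Z ⌝) ⨾ₑ (idₑ ⊕ₑ (⌜ σ⊕ X Y ⌝ ⊕ₑ idₑ))
                           ⨾ₑ (idₑ ⊕ₑ ⌜ α⊕ Y X Z ⌝) ⨾ₑ ⌜ α⊕⁻¹ W Y (X ⊕₀ Z) ⌝

module KleisliFcCdRig {o ℓ e} (C : Cat o ℓ e) (Tn Pl : MonoidalData C) (R : RigExtra C Tn Pl)
  (H : IsFcCdRig C Tn Pl R) (M : SymMonMonad C Tn) where
  open Cat C
  open MonoidalData Tn
  open MonoidalData Pl renaming (_⊗₀_ to _⊕₀_; _⊗₁_ to _⊕₁_; unit to O; α to α⊕; α⁻¹ to α⊕⁻¹;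
    unitorˡ to λ⊕; unitorˡ⁻¹ to λ⊕⁻¹; unitorʳ to ρ⊕; unitorʳ⁻¹ to ρ⊕⁻¹; σ to σ⊕)
  open RigExtra R
  open IsFcCdRig H
  open CategoryReasoning C isCategory
  open Coproducts C Tn Pl R H using (O-initial; retract-of-O-initial)
  open KleisliCategory C isCategory Tn ⊗-symmetricMonoidal M
  open KleisliCoproducts C Tn Pl R H M
  open StructuralTransfer C Tn Pl R H M
  module ⊗ = IsSymmetricMonoidal ⊗-symmetricMonoidal
  module ⊕ = IsSymmetricMonoidal ⊕-symmetricMonoidal

  kleisli-⊗-symmetricMonoidal : IsSymmetricMonoidal (Kleisli C Tn M) (KleisliTensor C Tn M)
  kleisli-⊗-symmetricMonoidal = record
    { ⊗-id            = ⊗ₖ-identity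
    ; ⊗-comp          = ⊗ₖ-homomorphism
    ; ⊗-resp-≈        = ⊗ₖ-resp
    ; α-natural       = ⊗ₖ-α-natural
    ; α-isoˡ          = λ A B D → transfer-inverse (⊗.α-isoˡ A B D)
    ; α-isoʳ          = λ A B D → transfer-inverse (⊗.α-isoʳ A B D)
    ; unitorˡ-natural = ⊗ₖ-λ-natural
    ; unitorˡ-isoˡ    = λ A → transfer-inverse (⊗.unitorˡ-isoˡ A)
    ; unitorˡ-isoʳ    = λ A → transfer-inverse (⊗.unitorˡ-isoʳ A)
    ; unitorʳ-natural = ⊗ₖ-ρ-natural
    ; unitorʳ-isoˡ    = λ A → transfer-inverse (⊗.unitorʳ-isoˡ A)
    ; unitorʳ-isoʳ    = λ A → transfer-inverse (⊗.unitorʳ-isoʳ A)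
    ; σ-natural       = ⊗ₖ-σ-natural
    ; σ-involutive    = λ A B → transfer-inverse (⊗.σ-involutive A B)
    ; pentagon        = λ A B D E → transfer
        ((⌜ α A B D ⌝ ⊗ₑ idₑ) ⨾ₑ ⌜ α A (B ⊗₀ D) E ⌝ ⨾ₑ (idₑ ⊗ₑ ⌜ α B D E ⌝))
        (⌜ α (A ⊗₀ B) D E ⌝ ⨾ₑ ⌜ α A B (D ⊗₀ E) ⌝) (⊗.pentagon A B D E)
    ; triangle        = λ A B → transfer
        (⌜ α A unit B ⌝ ⨾ₑ (idₑ ⊗ₑ ⌜ unitorˡ B ⌝)) (⌜ unitorʳ A ⌝ ⊗ₑ idₑ) (⊗.triangle A B)
    ; hexagon         = λ A B D → transfer
        (⌜ α A B D ⌝ ⨾ₑ ⌜ σ A (B ⊗₀ D) ⌝ ⨾ₑ ⌜ α B D A ⌝)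
        ((⌜ σ A B ⌝ ⊗ₑ idₑ) ⨾ₑ ⌜ α B A D ⌝ ⨾ₑ (idₑ ⊗ₑ ⌜ σ A D ⌝)) (⊗.hexagon A B D)
    }

  kleisli-⊕-symmetricMonoidal : IsSymmetricMonoidal (Kleisli C Tn M) (KleisliPlus C Tn M Pl R)
  kleisli-⊕-symmetricMonoidal = record
    { ⊗-id            = ⊕ₖ-identity
    ; ⊗-comp          = ⊕ₖ-homomorphism
    ; ⊗-resp-≈        = ⊕ₖ-resp
    ; α-natural       = ⊕ₖ-α-natural
    ; α-isoˡ          = λ A B D → transfer-inverse (⊕.α-isoˡ A B D)
    ; α-isoʳ          = λ A B D → transfer-inverse (⊕.α-isoʳ A B D)
    ; unitorˡ-natural = ⊕ₖ-λ-natural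
    ; unitorˡ-isoˡ    = λ A → transfer-inverse (⊕.unitorˡ-isoˡ A)
    ; unitorˡ-isoʳ    = λ A → transfer-inverse (⊕.unitorˡ-isoʳ A)
    ; unitorʳ-natural = ⊕ₖ-ρ-natural
    ; unitorʳ-isoˡ    = λ A → transfer-inverse (⊕.unitorʳ-isoˡ A)
    ; unitorʳ-isoʳ    = λ A → transfer-inverse (⊕.unitorʳ-isoʳ A)
    ; σ-natural       = ⊕ₖ-σ-natural
    ; σ-involutive    = λ A B → transfer-inverse (⊕.σ-involutive A B)
    ; pentagon        = λ A B D E → transfer
        ((⌜ α⊕ A B D ⌝ ⊕ₑ idₑ) ⨾ₑ ⌜ α⊕ A (B ⊕₀ D) E ⌝ ⨾ₑ (idₑ ⊕ₑ ⌜ α⊕ B D E ⌝))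
        (⌜ α⊕ (A ⊕₀ B) D E ⌝ ⨾ₑ ⌜ α⊕ A B (D ⊕₀ E) ⌝) (⊕.pentagon A B D E)
    ; triangle        = λ A B → transfer
        (⌜ α⊕ A O B ⌝ ⨾ₑ (idₑ ⊕ₑ ⌜ λ⊕ B ⌝)) (⌜ ρ⊕ A ⌝ ⊕ₑ idₑ) (⊕.triangle A B)
    ; hexagon         = λ A B D → transfer
        (⌜ α⊕ A B D ⌝ ⨾ₑ ⌜ σ⊕ A (B ⊕₀ D) ⌝ ⨾ₑ ⌜ α⊕ B D A ⌝)
        ((⌜ σ⊕ A B ⌝ ⊕ₑ idₑ) ⨾ₑ ⌜ α⊕ B A D ⌝ ⨾ₑ (idₑ ⊕ₑ ⌜ σ⊕ A D ⌝)) (⊕.hexagon A B D)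
    }

  kleisli-isFcCdRig : IsFcCdRig (Kleisli C Tn M) (KleisliTensor C Tn M) (KleisliPlus C Tn M Pl R) (KleisliRig C Tn M Pl R)
  kleisli-isFcCdRig = record
    { isCategory          = kleisli-isCategory
    ; ⊗-symmetricMonoidal = kleisli-⊗-symmetricMonoidal
    ; ⊕-symmetricMonoidal = kleisli-⊕-symmetricMonoidal
    ; δl-natural    = δlₖ-natural
    ; δl-isoˡ       = λ A B D → transfer-inverse (δl-isoˡ A B D)
    ; δl-isoʳ       = λ A B D → transfer-inverse (δl-isoʳ A B D)
    ; δr-natural    = δrₖ-natural
    ; δr-isoˡ       = λ A B D → transfer-inverse (δr-isoˡ A B D)
    ; δr-isoʳ       = λ A B D → transfer-inverse (δr-isoʳ A B D)
    ; annˡ-natural  = λ _ → retract-of-O-initial (annˡ-isoˡ _) _ _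
    ; annˡ-isoˡ     = λ A → transfer-inverse (annˡ-isoˡ A)
    ; annˡ-isoʳ     = λ A → transfer-inverse (annˡ-isoʳ A)
    ; annʳ-natural  = λ _ → retract-of-O-initial (annʳ-isoˡ _) _ _
    ; annʳ-isoˡ     = λ A → transfer-inverse (annʳ-isoˡ A)
    ; annʳ-isoʳ     = λ A → transfer-inverse (annʳ-isoʳ A)
    ; laplaza-I     = λ A B D → transfer
        (⌜ δl A B D ⌝ ⨾ₑ ⌜ σ⊕ _ _ ⌝) ((idₑ ⊗ₑ ⌜ σ⊕ B D ⌝) ⨾ₑ ⌜ δl A D B ⌝) (laplaza-I A B D)
    ; laplaza-II    = λ A B D → transfer
        (⌜ δr A B D ⌝ ⨾ₑ ⌜ σ⊕ _ _ ⌝) ((⌜ σ⊕ A B ⌝ ⊗ₑ idₑ) ⨾ₑ ⌜ δr B A D ⌝) (laplaza-II A B D)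
    ; laplaza-III   = λ A B D → transfer
        (⌜ σ (A ⊕₀ B) D ⌝ ⨾ₑ ⌜ δl D A B ⌝ ⨾ₑ (⌜ σ D A ⌝ ⊕ₑ ⌜ σ D B ⌝)) ⌜ δr A B D ⌝ (laplaza-III A B D)
    ; laplaza-IV    = λ A B D E → transfer
        (⌜ δl A B (D ⊕₀ E) ⌝ ⨾ₑ (idₑ ⊕ₑ ⌜ δl A D E ⌝) ⨾ₑ ⌜ α⊕⁻¹ _ _ _ ⌝)
        ((idₑ ⊗ₑ ⌜ α⊕⁻¹ B D E ⌝) ⨾ₑ ⌜ δl A (B ⊕₀ D) E ⌝ ⨾ₑ (⌜ δl A B D ⌝ ⊕ₑ idₑ)) (laplaza-IV A B D E)
    ; laplaza-V     = λ A B D E → transfer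
        (⌜ δr (A ⊕₀ B) D E ⌝ ⨾ₑ (⌜ δr A B E ⌝ ⊕ₑ idₑ) ⨾ₑ ⌜ α⊕ _ _ _ ⌝)
        ((⌜ α⊕ A B D ⌝ ⊗ₑ idₑ) ⨾ₑ ⌜ δr A (B ⊕₀ D) E ⌝ ⨾ₑ (idₑ ⊕ₑ ⌜ δr B D E ⌝)) (laplaza-V A B D E)
    ; laplaza-VI    = λ A B D E → transfer
        ((idₑ ⊗ₑ ⌜ δl B D E ⌝) ⨾ₑ ⌜ δl A _ _ ⌝ ⨾ₑ (⌜ α⁻¹ A B D ⌝ ⊕ₑ ⌜ α⁻¹ A B E ⌝))
        (⌜ α⁻¹ A B (D ⊕₀ E) ⌝ ⨾ₑ ⌜ δl (A ⊗₀ B) D E ⌝) (laplaza-VI A B D E)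
    ; laplaza-VII   = λ A B D E → transfer
        ((idₑ ⊗ₑ ⌜ δr B D E ⌝) ⨾ₑ ⌜ δl A _ _ ⌝ ⨾ₑ (⌜ α⁻¹ A B E ⌝ ⊕ₑ ⌜ α⁻¹ A D E ⌝))
        (⌜ α⁻¹ A (B ⊕₀ D) E ⌝ ⨾ₑ (⌜ δl A B D ⌝ ⊗ₑ idₑ) ⨾ₑ ⌜ δr _ _ E ⌝) (laplaza-VII A B D E)
    ; laplaza-VIII  = λ A B D E → transfer
        (⌜ α⁻¹ (A ⊕₀ B) D E ⌝ ⨾ₑ (⌜ δr A B D ⌝ ⊗ₑ idₑ) ⨾ₑ ⌜ δr _ _ E ⌝)
        (⌜ δr A B (D ⊗₀ E) ⌝ ⨾ₑ (⌜ α⁻¹ A D E ⌝ ⊕ₑ ⌜ α⁻¹ B D E ⌝)) (laplaza-VIII A B D E)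
    ; laplaza-IX    = λ A B D E → transfer
        (⌜ δr A B (D ⊕₀ E) ⌝ ⨾ₑ (⌜ δl A D E ⌝ ⊕ₑ ⌜ δl B D E ⌝) ⨾ₑ ⊕-interchangeₑ _ _ _ _)
        (⌜ δl (A ⊕₀ B) D E ⌝ ⨾ₑ (⌜ δr A B D ⌝ ⊕ₑ ⌜ δr A B E ⌝)) (laplaza-IX A B D E)
    ; laplaza-X     = laplaza-X ⟩⨾⟨refl
    ; laplaza-XI    = λ A B → transfer
        (⌜ δl O A B ⌝ ⨾ₑ (⌜ annˡ A ⌝ ⊕ₑ ⌜ annˡ B ⌝) ⨾ₑ ⌜ λ⊕ O ⌝) ⌜ annˡ (A ⊕₀ B) ⌝ (laplaza-XI A B)
    ; laplaza-XII   = λ A B → transfer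
        (⌜ δr A B O ⌝ ⨾ₑ (⌜ annʳ A ⌝ ⊕ₑ ⌜ annʳ B ⌝) ⨾ₑ ⌜ λ⊕ O ⌝) ⌜ annʳ (A ⊕₀ B) ⌝ (laplaza-XII A B)
    ; laplaza-XIII  = laplaza-XIII ⟩⨾⟨refl
    ; laplaza-XIV   = laplaza-XIV ⟩⨾⟨refl
    ; laplaza-XV    = λ A → transfer (⌜ σ A O ⌝ ⨾ₑ ⌜ annˡ A ⌝) ⌜ annʳ A ⌝ (laplaza-XV A)
    ; laplaza-XVI   = λ A B → transfer
        (⌜ α⁻¹ O A B ⌝ ⨾ₑ (⌜ annˡ A ⌝ ⊗ₑ idₑ) ⨾ₑ ⌜ annˡ B ⌝) ⌜ annˡ (A ⊗₀ B) ⌝ (laplaza-XVI A B)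
    ; laplaza-XVII  = λ A B → transfer
        (⌜ α⁻¹ A O B ⌝ ⨾ₑ (⌜ annʳ A ⌝ ⊗ₑ idₑ) ⨾ₑ ⌜ annˡ B ⌝) ((idₑ ⊗ₑ ⌜ annˡ B ⌝) ⨾ₑ ⌜ annʳ A ⌝) (laplaza-XVII A B)
    ; laplaza-XVIII = λ A B → transfer
        (⌜ α⁻¹ A B O ⌝ ⨾ₑ ⌜ annʳ (A ⊗₀ B) ⌝) ((idₑ ⊗ₑ ⌜ annʳ B ⌝) ⨾ₑ ⌜ annʳ A ⌝) (laplaza-XVIII A B)
    ; laplaza-XIX   = λ A B → transfer
        (⌜ δl A O B ⌝ ⨾ₑ (⌜ annʳ A ⌝ ⊕ₑ idₑ) ⨾ₑ ⌜ λ⊕ _ ⌝) (idₑ ⊗ₑ ⌜ λ⊕ B ⌝) (laplaza-XIX A B)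
    ; laplaza-XX    = λ A B → transfer
        (⌜ δr O A B ⌝ ⨾ₑ (⌜ annˡ B ⌝ ⊕ₑ idₑ) ⨾ₑ ⌜ λ⊕ _ ⌝) (⌜ λ⊕ A ⌝ ⊗ₑ idₑ) (laplaza-XX A B)
    ; laplaza-XXI   = λ A B → transfer
        (⌜ δl A B O ⌝ ⨾ₑ (idₑ ⊕ₑ ⌜ annʳ A ⌝) ⨾ₑ ⌜ ρ⊕ _ ⌝) (idₑ ⊗ₑ ⌜ ρ⊕ B ⌝) (laplaza-XXI A B)
    ; laplaza-XXII  = λ A B → transfer
        (⌜ δr A O B ⌝ ⨾ₑ (idₑ ⊕ₑ ⌜ annˡ B ⌝) ⨾ₑ ⌜ ρ⊕ _ ⌝) (⌜ ρ⊕ A ⌝ ⊗ₑ idₑ) (laplaza-XXII A B)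
    ; laplaza-XXIII = λ A B → transfer
        (⌜ δl unit A B ⌝ ⨾ₑ (⌜ unitorˡ A ⌝ ⊕ₑ ⌜ unitorˡ B ⌝)) ⌜ unitorˡ _ ⌝ (laplaza-XXIII A B)
    ; laplaza-XXIV  = λ A B → transfer
        (⌜ δr A B unit ⌝ ⨾ₑ (⌜ unitorʳ A ⌝ ⊕ₑ ⌜ unitorʳ B ⌝)) ⌜ unitorʳ _ ⌝ (laplaza-XXIV A B)
    ; ∇-natural     = ∇ₖ-natural
    ; ¡-natural     = λ _ → O-initial _ _
    ; ∇-assoc       = λ A → transfer
        ((⌜ ∇ A ⌝ ⊕ₑ idₑ) ⨾ₑ ⌜ ∇ A ⌝) (⌜ α⊕ A A A ⌝ ⨾ₑ (idₑ ⊕ₑ ⌜ ∇ A ⌝) ⨾ₑ ⌜ ∇ A ⌝) (∇-assoc A)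
    ; ∇-unitˡ       = λ A → transfer ((⌜ ¡ A ⌝ ⊕ₑ idₑ) ⨾ₑ ⌜ ∇ A ⌝) ⌜ λ⊕ A ⌝ (∇-unitˡ A)
    ; ∇-unitʳ       = λ A → transfer ((idₑ ⊕ₑ ⌜ ¡ A ⌝) ⨾ₑ ⌜ ∇ A ⌝) ⌜ ρ⊕ A ⌝ (∇-unitʳ A)
    ; ∇-comm        = λ A → transfer (⌜ σ⊕ A A ⌝ ⨾ₑ ⌜ ∇ A ⌝) ⌜ ∇ A ⌝ (∇-comm A)
    ; ∇-coh-⊕       = λ A B → transfer
        ⌜ ∇ (A ⊕₀ B) ⌝ (⊕-interchangeₑ A B A B ⨾ₑ (⌜ ∇ A ⌝ ⊕ₑ ⌜ ∇ B ⌝)) (∇-coh-⊕ A B)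
    ; ¡-coh-⊕       = λ A B → transfer ⌜ ¡ (A ⊕₀ B) ⌝ (⌜ λ⊕⁻¹ O ⌝ ⨾ₑ (⌜ ¡ A ⌝ ⊕ₑ ⌜ ¡ B ⌝)) (¡-coh-⊕ A B)
    ; ∇-coh-O       = ∇-coh-O ⟩⨾⟨refl
    ; ¡-coh-O       = transfer ⌜ ¡ O ⌝ idₑ ¡-coh-O
    ; copy-coassoc  = λ A → transfer
        (⌜ copy A ⌝ ⨾ₑ (⌜ copy A ⌝ ⊗ₑ idₑ) ⨾ₑ ⌜ α A A A ⌝) (⌜ copy A ⌝ ⨾ₑ (idₑ ⊗ₑ ⌜ copy A ⌝)) (copy-coassoc A)
    ; copy-counitˡ  = λ A → transfer (⌜ copy A ⌝ ⨾ₑ (⌜ disc A ⌝ ⊗ₑ idₑ) ⨾ₑ ⌜ unitorˡ A ⌝) idₑ (copy-counitˡ A)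
    ; copy-counitʳ  = λ A → transfer (⌜ copy A ⌝ ⨾ₑ (idₑ ⊗ₑ ⌜ disc A ⌝) ⨾ₑ ⌜ unitorʳ A ⌝) idₑ (copy-counitʳ A)
    ; copy-cocomm   = λ A → transfer (⌜ copy A ⌝ ⨾ₑ ⌜ σ A A ⌝) ⌜ copy A ⌝ (copy-cocomm A)
    ; copy-coh-⊗    = λ A B → transfer
        ⌜ copy (A ⊗₀ B) ⌝ ((⌜ copy A ⌝ ⊗ₑ ⌜ copy B ⌝) ⨾ₑ ⊗-interchangeₑ A A B B) (copy-coh-⊗ A B)
    ; disc-coh-⊗    = λ A B → transfer
        ⌜ disc (A ⊗₀ B) ⌝ ((⌜ disc A ⌝ ⊗ₑ ⌜ disc B ⌝) ⨾ₑ ⌜ unitorˡ unit ⌝) (disc-coh-⊗ A B)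
    ; copy-coh-I    = copy-coh-I ⟩⨾⟨refl
    ; disc-coh-I    = transfer ⌜ disc unit ⌝ idₑ disc-coh-I
    ; disc-coh-⊕    = λ A B → transfer
        ⌜ disc (A ⊕₀ B) ⌝ ((⌜ disc A ⌝ ⊕ₑ ⌜ disc B ⌝) ⨾ₑ ⌜ ∇ unit ⌝) (disc-coh-⊕ A B)
    ; copy-coh-⊕    = λ A B → transfer ⌜ copy (A ⊕₀ B) ⌝
        ((⌜ ρ⊕⁻¹ A ⌝ ⊕ₑ ⌜ λ⊕⁻¹ B ⌝) ⨾ₑ ((⌜ copy A ⌝ ⊕ₑ ⌜ ¡ (A ⊗₀ B) ⌝) ⊕ₑ (⌜ ¡ (B ⊗₀ A) ⌝ ⊕ₑ ⌜ copy B ⌝))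
          ⨾ₑ (⌜ δl⁻¹ A A B ⌝ ⊕ₑ ⌜ δl⁻¹ B A B ⌝) ⨾ₑ ⌜ δr⁻¹ A B (A ⊕₀ B) ⌝)
        (copy-coh-⊕ A B)
    }

proposition15 : ∀ {o ℓ e} (C : Cat o ℓ e) (Tn Pl : MonoidalData C) (R : RigExtra C Tn Pl)
    → IsFcCdRig C Tn Pl R
    → (M : SymMonMonad C Tn)
    → IsFcCdRig (Kleisli C Tn M) (KleisliTensor C Tn M) (KleisliPlus C Tn M Pl R) (KleisliRig C Tn M Pl R)
proposition15 C Tn Pl R H M = KleisliFcCdRig.kleisli-isFcCdRig C Tn Pl R H M
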